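{- Let $g\ge 0$ and $n\ge 0$ be integers. There is a bijection $$\theta\colon \dot\bigcup_{0\le g_1\le g+1,\;0\le j\le n}\bigl(U_{g_1,j}\times U_{g+1-g_1,\,n-j}\bigr)\longrightarrow U^{III}_{g+1,n+1}.$$
   Context: Planted unicellular maps. For an integer $n\ge 0$ let $H_n=\{r,1,2,\dots,2n,p\}$ (a set of $2n+2$ symbols, linearly ordered by $r<1<2<\dots<2n<p$), and let $\gamma_n$ be the cyclic permutation $(r,1,2,\dots,2n,p)$ of $H_n$. A planted unicellular map with $n$ edges is a fixed-point-free involution $\alpha$ of $H_n$ with $\alpha(r)=p$. Its vertex permutation is $\sigma=\alpha\circ\gamma_n$, so that $\alpha\circ\sigma=\gamma_n$ consists of a single cycle (the unique face) and $\sigma(p)=p$ ($p$ is the plant, a vertex of degree one). The vertices are the cycles of $\sigma$ (including the plant $(p)$), the edges are the cycles of $\alpha$ other than $(r,p)$. The genus $g$ of the map is defined by $V-(n+1)+1=2-2g$, where $V$ is the number of cycles of $\sigma$. $U_{g,n}$ denotes the set of planted unicellular maps with $n$ edges and genus $g$. The class $U^{III}_{g+1,n+1}$: for $\alpha\in U_{g+1,n+1}$ (on $H_{n+1}=\{r,1,\dots,2n+2,p\}$ with the order above), $\alpha\in U^{III}_{g+1,n+1}$ iff the half-edges $1$ and $\alpha(1)$ lie in two different cycles of $\sigma=\alpha\circ\gamma_{n+1}$ and for every $k\in H_{n+1}$ with $1<k<\alpha(1)$ one has $\alpha(k)<\alpha(1)$. -}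

module Defs where

open import Data.Nat as ℕ using (ℕ; zero; suc; _+_; _*_; _∸_)
open import Data.Nat.DivMod using (_mod_)
open import Data.Fin as Fin using (Fin; toℕ; fromℕ; _≤_; _<_; _≤?_)
open import Data.Fin.Properties using (all?)
open import Data.List using (length; filter; allFin)
open import Data.Vec using (Vec; lookup)
open import Data.Product using (Σ; ∃; _×_)
open import Relation.Nullary using (¬_)
open import Relation.Binary.PropositionalEquality using (_≡_; _≢_)

-- Size of H_n = {r,1,...,2n,p}: 2n+2 symbols.
-- Encoding: r ↦ 0, i ↦ i (1 ≤ i ≤ 2n), p ↦ 2n+1; the order of Fin is the order r<1<...<2n<p.
size : ℕ → ℕ
size n = suc (suc (2 * n))

H : ℕ → Set
H n = Fin (size n)

r : ∀ n → H n
r n = Fin.zero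

p : ∀ n → H n
p n = fromℕ (suc (2 * n))

γ : ∀ n → H n → H n
γ n x = suc (toℕ x) mod size n

iter : ∀ {A : Set} → (A → A) → ℕ → A → A
iter f zero    x = x
iter f (suc k) x = f (iter f k x)

σ : ∀ n → (H n → H n) → H n → H n
σ n α x = α (γ n x)

-- x is the least element of its cycle under a permutation π of Fin m
-- (the orbit of x is {π^k x : k < m})
IsCycleMin : ∀ {m} → (Fin m → Fin m) → Fin m → Set
IsCycleMin {m} π x = (k : Fin m) → x ≤ iter π (toℕ k) x

-- number of cycles of a permutation π of Fin m (= number of cycle minima)
numCycles : ∀ m → (Fin m → Fin m) → ℕ
numCycles m π =
  length (filter (λ x → all? {m} (λ k → x ≤? iter π (toℕ k) x)) (allFin m))

SameCycle : ∀ {m} → (Fin m → Fin m) → Fin m → Fin m → Set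
SameCycle π x y = ∃ λ k → iter π k x ≡ y

-- α is a planted unicellular map with n edges and genus g:
-- fixed-point-free involution with α(r)=p, and V - (n+1) + 1 = 2 - 2g,
-- i.e. V + 2g = n + 2, where V = number of cycles of σ = α ∘ γ_n.
record IsU (g n : ℕ) (α : H n → H n) : Set where
  field
    involution : ∀ x → α (α x) ≡ x
    fixedPointFree : ∀ x → α x ≢ x
    root : α (r n) ≡ p n
    genus : numCycles (size n) (σ n α) + 2 * g ≡ n + 2

-- U_{g,n}: the involution is stored as a table (so equality is decidable
-- and propositional); the defining properties are an irrelevant field,
-- so two elements are equal iff their involutions are equal.
record U (g n : ℕ) : Set where
  constructor mkU
  field
    table : Vec (H n) (size n)
    .isU : IsU g n (lookup table)

open U public

inv : ∀ {g n} → U g n → H n → H n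
inv m = lookup (table m)

one : ∀ n → H (suc n)
one n = Fin.suc Fin.zero

IsIII : ∀ {g n} → U (suc g) (suc n) → Set
IsIII {g} {n} m =
  ¬ SameCycle (σ (suc n) (inv m)) (one n) (inv m (one n))
  × (∀ (k : H (suc n)) → one n < k → k < inv m (one n) → inv m k < inv m (one n))

-- UIII g n  is  U^{III}_{g+1,n+1}
record UIII (g n : ℕ) : Set where
  constructor mkUIII
  field
    map : U (suc g) (suc n)
    .isIII : IsIII map

Domain : ℕ → ℕ → Set
Domain g n =
  Σ (Fin (suc (suc g))) λ g₁ → Σ (Fin (suc n)) λ j →
    U (toℕ g₁) (toℕ j) × U (suc g ∸ toℕ g₁) (n ∸ toℕ j)

-- θ glues A onto the half-edges 1, …, 2j+2 and B onto r and 2j+3, …, 2n+3, so that α 1 = 2j+2 = σα r.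
-- Composing σα with the transposition (r, α 1) adds one cycle, and the result fixes r and p and acts as
-- σA on 1, …, 2j+1 and as σB on 2j+2, …, 2n+2; counting cycles gives V + 1 = V_A + V_B, so the genera
-- add up.  The half-edges 1, …, 2j+1 form a union of σα-cycles not containing α 1, so α has type III.
-- Conversely, for α of type III the block {1, …, α 1} is closed under α, hence has even size 2j+2, and
-- α restricts to planted maps A on it and B on its complement.  Their genera exist because multiplying
-- γ by the n+1 transpositions of a fixed-point-free involution changes the number of cycles by ±1 each
-- time, and they add up to g+1 by the count above.  θ is injective since j, A, B and the genus of A are
-- read off α.

module Submission where

open import Defs
open import Algebra.Definitions using (Involutive)
import Data.Nat.Properties as ℕP
open import Algebra.Properties.CommutativeSemigroup ℕP.+-commutativeSemigroup using (interchange)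
open import Data.Empty using (⊥)
open import Data.Fin as Fin using (Fin; toℕ; fromℕ<)
import Data.Fin.Properties as FP
open import Data.Fin.Permutation.Components using (transpose)
open import Data.List as List using (List; _∷_; length; filter)
open import Data.Nat as ℕ using (ℕ; zero; suc; _+_; _*_; _∸_; z≤n; s≤s; _≤_; _<_; _≤?_; _<?_)
open import Data.Nat.DivMod using (_%_; _/_; _mod_; m≡m%n+[m/n]*n; m%n<n; m<n⇒m%n≡m; n%n≡0)
open import Data.Nat.Tactic.RingSolver using (solve-∀)
open import Data.Product using (Σ; ∃; _×_; _,_; proj₁; proj₂)
open import Data.Sum as Sum using (_⊎_; inj₁; inj₂; [_,_]′)
open import Data.Vec using (lookup; tabulate)
open import Data.Vec.Properties using (lookup∘tabulate; tabulate∘lookup; tabulate-cong)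
open import Function.Base using (_∘_; id)
open import Function.Bundles using (_⤖_; mk⤖)
open import Function.Definitions using (Injective)
open import Relation.Binary.Definitions using (tri<; tri≈; tri>)
open import Relation.Binary.PropositionalEquality
open import Relation.Nullary using (¬_; Dec; yes; no; contradiction)
open import Relation.Nullary.Decidable using (map′; ¬?; decidable-stable; _×-dec_; _⊎-dec_; _→-dec_; recompute)
open import Relation.Unary using (Decidable)

private variable
  A : Set
  g m n : ℕ
  P Q : ℕ → Set

iter-+ : (f : A → A) (a b : ℕ) (x : A) → iter f (a + b) x ≡ iter f a (iter f b x)
iter-+ f zero    b x = refl
iter-+ f (suc a) b x = cong f (iter-+ f a b x)

iter-cong : {f g : A → A} → (∀ x → f x ≡ g x) → ∀ k x → iter f k x ≡ iter g k x
iter-cong e zero    x = refl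
iter-cong {f = f} e (suc k) x = trans (cong f (iter-cong e k x)) (e _)

iter-preserves : {f : A → A} (S : A → Set) → (∀ w → S w → S (f w)) → ∀ k {x} → S x → S (iter f k x)
iter-preserves S cl zero    s = s
iter-preserves S cl (suc k) s = cl _ (iter-preserves S cl k s)

iter-fixed : {f : A → A} {x : A} → f x ≡ x → ∀ k → iter f k x ≡ x
iter-fixed e zero    = refl
iter-fixed {f = f} e (suc k) = trans (cong f (iter-fixed e k)) e

iter-injective : {f : A → A} → Injective _≡_ _≡_ f → ∀ k {x y} → iter f k x ≡ iter f k y → x ≡ y
iter-injective inj zero    e = e
iter-injective inj (suc k) e = iter-injective inj k (inj e)

iter-*-period : {f : A → A} {d : ℕ} {x : A} → iter f d x ≡ x → ∀ q → iter f (q * d) x ≡ x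
iter-*-period e zero = refl
iter-*-period {f = f} {d} {x} e (suc q) =
  trans (iter-+ f d (q * d) x) (trans (cong (iter f d) (iter-*-period e q)) e)

iter-%-period : {f : A → A} {d : ℕ} {x : A} → iter f (suc d) x ≡ x → ∀ t → iter f t x ≡ iter f (t % suc d) x
iter-%-period {f = f} {d} {x} e t = begin
  iter f t x                                       ≡⟨ cong (λ s → iter f s x) (m≡m%n+[m/n]*n t (suc d)) ⟩
  iter f (t % suc d + t / suc d * suc d) x         ≡⟨ iter-+ f (t % suc d) _ x ⟩
  iter f (t % suc d) (iter f (t / suc d * suc d) x) ≡⟨ cong (iter f (t % suc d)) (iter-*-period e (t / suc d)) ⟩
  iter f (t % suc d) x                             ∎
  where open ≡-Reasoning

iter-intertwine : {B : Set} {π : A → A} {ρ : B → B} (S : A → Set) → (∀ x → S x → S (π x)) →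
  (e : A → B) → (∀ x → S x → ρ (e x) ≡ e (π x)) → ∀ k {x} → S x → iter ρ k (e x) ≡ e (iter π k x)
iter-intertwine S cl e comm zero    sx = refl
iter-intertwine {ρ = ρ} S cl e comm (suc k) sx =
  trans (cong ρ (iter-intertwine S cl e comm k sx)) (comm _ (iter-preserves S cl k sx))

sameCycle-refl : {π : Fin m → Fin m} {x : Fin m} → SameCycle π x x
sameCycle-refl = 0 , refl

sameCycle-step : {π : Fin m → Fin m} {x : Fin m} → SameCycle π x (π x)
sameCycle-step = 1 , refl

sameCycle-trans : {π : Fin m → Fin m} {x y z : Fin m} → SameCycle π x y → SameCycle π y z → SameCycle π x z
sameCycle-trans {π = π} {x} (k , refl) (l , refl) = l + k , iter-+ π l k x

module _ {π : Fin m → Fin m} (inj : Injective _≡_ _≡_ π) where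

  period : ∀ x → ∃ λ d → 0 < d × d ≤ m × iter π d x ≡ x
  period x with FP.pigeonhole (ℕP.n<1+n m) (λ (i : Fin (suc m)) → iter π (toℕ i) x)
  ... | i , j , i<j , e = toℕ j ∸ toℕ i , ℕP.m<n⇒0<n∸m i<j , d≤m , sym (iter-injective inj (toℕ i) e′)
    where
    d≤m : toℕ j ∸ toℕ i ≤ m
    d≤m = ℕP.≤-trans (ℕP.m∸n≤m (toℕ j) (toℕ i)) (ℕP.≤-pred (FP.toℕ<n j))
    e′ : iter π (toℕ i) x ≡ iter π (toℕ i) (iter π (toℕ j ∸ toℕ i) x)
    e′ = trans e (trans (cong (λ t → iter π t x) (sym (ℕP.m+[n∸m]≡n (ℕP.<⇒≤ i<j))))
                        (iter-+ π (toℕ i) _ x))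

  sameCycle-bounded : ∀ {x y} → SameCycle π x y → ∃ λ k → k < m × iter π k x ≡ y
  sameCycle-bounded {x} (t , e) with period x
  ... | suc d , _ , d≤m , πᵈx≡x =
    t % suc d , ℕP.<-≤-trans (m%n<n t (suc d)) d≤m , trans (sym (iter-%-period πᵈx≡x t)) e

  sameCycle-sym : ∀ {x y} → SameCycle π x y → SameCycle π y x
  sameCycle-sym {x} (t , refl) with period x
  ... | suc d , _ , _ , πᵈx≡x = suc d ∸ t % suc d , (begin
    iter π (suc d ∸ t % suc d) (iter π t x)              ≡⟨ cong (iter π (suc d ∸ t % suc d)) (iter-%-period {f = π} πᵈx≡x t) ⟩
    iter π (suc d ∸ t % suc d) (iter π (t % suc d) x)    ≡⟨ iter-+ π (suc d ∸ t % suc d) _ x ⟨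
    iter π (suc d ∸ t % suc d + t % suc d) x             ≡⟨ cong (λ s → iter π s x) (ℕP.m∸n+n≡m (ℕP.<⇒≤ (m%n<n t (suc d)))) ⟩
    iter π (suc d) x                                     ≡⟨ πᵈx≡x ⟩
    x                                                    ∎)
    where open ≡-Reasoning

  sameCycle? : ∀ x y → Dec (SameCycle π x y)
  sameCycle? x y = map′ (λ (k , e) → toℕ k , e) from (FP.any? (λ (k : Fin m) → iter π (toℕ k) x FP.≟ y))
    where
    from : SameCycle π x y → ∃ λ (k : Fin m) → iter π (toℕ k) x ≡ y
    from c with sameCycle-bounded c
    ... | k , k<m , e = fromℕ< k<m , trans (cong (λ s → iter π s x) (FP.toℕ-fromℕ< k<m)) e

toℕ-inject-fromℕ< : {i : Fin n} {k : ℕ} (k<i : k < toℕ i) → toℕ (Fin.inject (fromℕ< k<i)) ≡ k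
toℕ-inject-fromℕ< k<i = trans (FP.toℕ-inject (fromℕ< k<i)) (FP.toℕ-fromℕ< k<i)

least : {P : ℕ → Set} → Decidable P → ∀ {n} → P n → ∃ λ k → P k × ∀ i → i < k → ¬ P i
least {P} P? {n} pn with FP.¬∀⟶∃¬-smallest (suc n) (λ i → ¬ P (toℕ i)) (λ i → ¬? (P? (toℕ i)))
                                              (λ ¬P → ¬P (Fin.fromℕ n) (subst P (sym (FP.toℕ-fromℕ n)) pn))
... | k , ¬¬pk , below =
  toℕ k , decidable-stable (P? (toℕ k)) ¬¬pk , λ i i<k → subst (¬_ ∘ P) (toℕ-inject-fromℕ< i<k) (below (fromℕ< i<k))

isCycleMin? : (π : Fin m → Fin m) → Decidable (IsCycleMin π)
isCycleMin? {m} π x = FP.all? {m} λ k → x Fin.≤? iter π (toℕ k) x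

IsLeastInCycle : (Fin m → Fin m) → Fin m → Set
IsLeastInCycle π x = ∀ y → SameCycle π x y → x Fin.≤ y

isLeastInCycle⇒isCycleMin : {π : Fin m → Fin m} {x : Fin m} → IsLeastInCycle π x → IsCycleMin π x
isLeastInCycle⇒isCycleMin least k = least _ (toℕ k , refl)

fixedPoint⇒isLeastInCycle : {π : Fin m → Fin m} {x : Fin m} → π x ≡ x → IsLeastInCycle π x
fixedPoint⇒isLeastInCycle πx≡x y (k , refl) = FP.≤-reflexive (sym (iter-fixed πx≡x k))

module _ {π : Fin m → Fin m} (inj : Injective _≡_ _≡_ π) where

  isCycleMin⇒isLeastInCycle : ∀ {x} → IsCycleMin π x → IsLeastInCycle π x
  isCycleMin⇒isLeastInCycle {x} min y c with sameCycle-bounded inj c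
  ... | k , k<m , refl = subst (λ s → x Fin.≤ iter π s x) (FP.toℕ-fromℕ< k<m) (min (fromℕ< k<m))

  isLeastInCycle? : Decidable (IsLeastInCycle π)
  isLeastInCycle? x = map′ isCycleMin⇒isLeastInCycle isLeastInCycle⇒isCycleMin (isCycleMin? π x)

  leastInCycle-unique : ∀ {x y} → IsLeastInCycle π x → IsLeastInCycle π y → SameCycle π x y → x ≡ y
  leastInCycle-unique x-least y-least c = FP.≤-antisym (x-least _ c) (y-least _ (sameCycle-sym inj c))

  leastInCycle : ∀ x → ∃ λ z → SameCycle π x z × IsLeastInCycle π z
  leastInCycle x with FP.¬∀⟶∃¬-smallest m (λ y → ¬ SameCycle π x y) (λ y → ¬? (sameCycle? inj x y))
                                         (λ ¬C → ¬C x sameCycle-refl)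
  ... | z , ¬¬x~z , below = z , x~z , λ y z~y → ℕP.≮⇒≥ λ y<z →
    below (fromℕ< y<z) (subst (SameCycle π x) (sym (FP.toℕ-injective (toℕ-inject-fromℕ< y<z)))
                               (sameCycle-trans x~z z~y))
    where
    x~z : SameCycle π x z
    x~z = decidable-stable (sameCycle? inj x z) ¬¬x~z

indicator : Dec A → ℕ
indicator (yes _) = 1
indicator (no _)  = 0

indicator-yes : (a? : Dec A) → A → indicator a? ≡ 1
indicator-yes (yes _) _ = refl
indicator-yes (no ¬a) a = contradiction a ¬a

indicator-no : (a? : Dec A) → ¬ A → indicator a? ≡ 0
indicator-no (yes a) ¬a = contradiction a ¬a
indicator-no (no _)  _  = refl

indicator-cong : {B : Set} → (A → B) → (B → A) → (a? : Dec A) (b? : Dec B) → indicator a? ≡ indicator b?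
indicator-cong f g (yes a) b? = sym (indicator-yes b? (f a))
indicator-cong f g (no ¬a) b? = sym (indicator-no b? (¬a ∘ g))

-- Predicates are counted on ℕ so that ranges of positions can be split with count-+;
-- AtFin reads a predicate on Fin m at a natural number, and is false from m on.
count : Decidable P → ℕ → ℕ
count P? zero    = 0
count P? (suc n) = count P? n + indicator (P? n)

count-cong : (P? : Decidable P) (Q? : Decidable Q) → ∀ n →
  (∀ k → k < n → P k → Q k) → (∀ k → k < n → Q k → P k) → count P? n ≡ count Q? n
count-cong P? Q? zero    f g = refl
count-cong P? Q? (suc n) f g = cong₂ _+_
  (count-cong P? Q? n (λ k → f k ∘ ℕP.m<n⇒m<1+n) (λ k → g k ∘ ℕP.m<n⇒m<1+n))
  (indicator-cong (f n (ℕP.n<1+n n)) (g n (ℕP.n<1+n n)) (P? n) (Q? n))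

count-+ : (P? : Decidable P) → ∀ a b → count P? (a + b) ≡ count P? a + count (P? ∘ (a +_)) b
count-+ P? a zero    = trans (cong (count P?) (ℕP.+-identityʳ a)) (sym (ℕP.+-identityʳ _))
count-+ P? a (suc b) = trans (cong (count P?) (ℕP.+-suc a b))
  (trans (cong (_+ indicator (P? (a + b))) (count-+ P? a b)) (ℕP.+-assoc (count P? a) _ _))

count-none : (P? : Decidable P) → ∀ n → (∀ k → k < n → ¬ P k) → count P? n ≡ 0
count-none P? zero    h = refl
count-none P? (suc n) h = cong₂ _+_ (count-none P? n (λ k → h k ∘ ℕP.m<n⇒m<1+n)) (indicator-no (P? n) (h n (ℕP.n<1+n n)))

count-all : (P? : Decidable P) → ∀ n → (∀ k → k < n → P k) → count P? n ≡ n
count-all P? zero    h = refl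
count-all P? (suc n) h = trans (cong₂ _+_ (count-all P? n (λ k → h k ∘ ℕP.m<n⇒m<1+n)) (indicator-yes (P? n) (h n (ℕP.n<1+n n))))
                               (ℕP.+-comm n 1)

count≡0⇒none : (P? : Decidable P) → ∀ n → count P? n ≡ 0 → ∀ k → k < n → ¬ P k
count≡0⇒none P? zero    e k () pk
count≡0⇒none P? (suc n) e k k<1+n pk with P? n | ℕP.m≤n⇒m<n∨m≡n (ℕP.≤-pred k<1+n)
... | yes _  | _          = contradiction (trans (sym (ℕP.+-comm (count P? n) 1)) e) λ ()
... | no _   | inj₁ k<n   = count≡0⇒none P? n (trans (sym (ℕP.+-identityʳ _)) e) k k<n pk
... | no ¬pn | inj₂ refl  = ¬pn pk

count≢0⇒some : (P? : Decidable P) → ∀ n {c} → count P? n ≡ suc c → ∃ λ k → k < n × P k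
count≢0⇒some P? (suc n) e with P? n
... | yes pn = n , ℕP.n<1+n n , pn
... | no _ with count≢0⇒some P? n (trans (sym (ℕP.+-identityʳ _)) e)
...   | k , k<n , pk = k , ℕP.m<n⇒m<1+n k<n , pk

count-insert : (P? : Decidable P) (Q? : Decidable Q) → ∀ n w → w < n → ¬ P w →
  (∀ k → k < n → Q k → P k ⊎ k ≡ w) → (∀ k → k < n → P k ⊎ k ≡ w → Q k) →
  count Q? n ≡ suc (count P? n)
count-insert {P} {Q} P? Q? (suc n) w w<1+n ¬pw f g with ℕP.m≤n⇒m<n∨m≡n (ℕP.≤-pred w<1+n)
... | inj₁ w<n = cong₂ _+_
  (count-insert P? Q? n w w<n ¬pw (λ k → f k ∘ ℕP.m<n⇒m<1+n) (λ k → g k ∘ ℕP.m<n⇒m<1+n))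
  (indicator-cong (Q⇒P (ℕP.<⇒≢ w<n ∘ sym) (ℕP.n<1+n n)) (g n (ℕP.n<1+n n) ∘ inj₁) (Q? n) (P? n))
  where
  Q⇒P : ∀ {k} → k ≢ w → k < suc n → Q k → P k
  Q⇒P k≢w k< qk = [ id , (λ k≡w → contradiction k≡w k≢w) ]′ (f _ k< qk)
... | inj₂ refl = begin
  count Q? w + indicator (Q? w)   ≡⟨ cong₂ _+_ before (indicator-yes (Q? w) (g w (ℕP.n<1+n w) (inj₂ refl))) ⟩
  count P? w + 1                  ≡⟨ ℕP.+-comm _ 1 ⟩
  suc (count P? w)                ≡⟨ cong suc (ℕP.+-identityʳ _) ⟨
  suc (count P? w + 0)            ≡⟨ cong (suc ∘ (count P? w +_)) (indicator-no (P? w) ¬pw) ⟨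
  suc (count P? w + indicator (P? w)) ∎
  where
  open ≡-Reasoning
  before : count Q? w ≡ count P? w
  before = count-cong Q? P? w
    (λ k k<w qk → [ id , (λ k≡w → contradiction k≡w (ℕP.<⇒≢ k<w)) ]′ (f k (ℕP.m<n⇒m<1+n k<w) qk))
    (λ k k<w pk → g k (ℕP.m<n⇒m<1+n k<w) (inj₁ pk))

AtFin : (Fin m → Set) → ℕ → Set
AtFin {m} R k = Σ (k < m) λ k<m → R (fromℕ< k<m)

atFin? : {R : Fin m → Set} → Decidable R → Decidable (AtFin R)
atFin? {m} R? k with k <? m
... | no k≮m = no (k≮m ∘ proj₁)
... | yes k<m with R? (fromℕ< k<m)
...   | yes r = yes (k<m , r)
...   | no ¬r = no λ (_ , r) → ¬r r

countFin : {R : Fin m → Set} → Decidable R → ℕ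
countFin {m} R? = count (atFin? R?) m

length-filter-∷ : {R : A → Set} (R? : Decidable R) (x : A) (xs : List A) →
  length (filter R? (x ∷ xs)) ≡ indicator (R? x) + length (filter R? xs)
length-filter-∷ R? x xs with R? x
... | yes _ = refl
... | no _  = refl

length-filter-tabulate : {R : A → Set} (R? : Decidable R) (f : Fin m → A) →
  length (filter R? (List.tabulate f)) ≡ countFin (R? ∘ f)
length-filter-tabulate {m = zero}  R? f = refl
length-filter-tabulate {m = suc m} R? f = begin
  length (filter R? (List.tabulate f))
    ≡⟨ length-filter-∷ R? (f Fin.zero) (List.tabulate (f ∘ Fin.suc)) ⟩
  indicator (R? (f Fin.zero)) + length (filter R? (List.tabulate (f ∘ Fin.suc)))
    ≡⟨ cong₂ _+_ (indicator-cong (ℕ.z<s ,_) proj₂ (R? (f Fin.zero)) (atFin? (R? ∘ f) 0))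
                 (trans (length-filter-tabulate R? (f ∘ Fin.suc))
                        (count-cong _ _ m (λ _ _ (k<m , r) → s≤s k<m , r) (λ _ _ (k<m , r) → ℕP.≤-pred k<m , r))) ⟩
  count (atFin? (R? ∘ f)) 1 + count (atFin? (R? ∘ f) ∘ (1 +_)) m
    ≡⟨ count-+ (atFin? (R? ∘ f)) 1 m ⟨
  countFin (R? ∘ f) ∎
  where open ≡-Reasoning

module _ {R S : Fin m → Set} (R? : Decidable R) (S? : Decidable S) where

  countFin-cong : (∀ x → R x → S x) → (∀ x → S x → R x) → countFin R? ≡ countFin S?
  countFin-cong f g = count-cong (atFin? R?) (atFin? S?) m (λ _ _ (h , r) → h , f _ r) (λ _ _ (h , s) → h , g _ s)

  countFin-insert : ∀ w → ¬ R w → (∀ x → S x → R x ⊎ x ≡ w) → (∀ x → R x ⊎ x ≡ w → S x) →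
    countFin S? ≡ suc (countFin R?)
  countFin-insert w ¬rw f g = count-insert (atFin? R?) (atFin? S?) m (toℕ w) (FP.toℕ<n w) ¬rw′ f′ g′
    where
    fromℕ<-toℕ : ∀ {k} (k<m : k < m) → k ≡ toℕ w → fromℕ< k<m ≡ w
    fromℕ<-toℕ k<m refl = FP.fromℕ<-toℕ w k<m
    ¬rw′ : ¬ AtFin R (toℕ w)
    ¬rw′ (k<m , r) = ¬rw (subst R (fromℕ<-toℕ k<m refl) r)
    f′ : ∀ k → k < m → AtFin S k → AtFin R k ⊎ k ≡ toℕ w
    f′ k _ (k<m , s) with f _ s
    ... | inj₁ r = inj₁ (k<m , r)
    ... | inj₂ e = inj₂ (trans (sym (FP.toℕ-fromℕ< k<m)) (cong toℕ e))
    g′ : ∀ k → k < m → AtFin R k ⊎ k ≡ toℕ w → AtFin S k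
    g′ k _   (inj₁ (k<m , r)) = k<m , g _ (inj₁ r)
    g′ k k<m (inj₂ k≡w)       = k<m , g _ (inj₂ (fromℕ<-toℕ k<m k≡w))

countFin-none : {R : Fin m → Set} (R? : Decidable R) → (∀ x → ¬ R x) → countFin R? ≡ 0
countFin-none {m} R? ¬r = count-none (atFin? R?) m λ _ _ (_ , r) → ¬r _ r

countFin-all : {R : Fin m → Set} (R? : Decidable R) → (∀ x → R x) → countFin R? ≡ m
countFin-all {m} R? r = count-all (atFin? R?) m λ _ k<m → k<m , r _

countFin≡0⇒none : {R : Fin m → Set} (R? : Decidable R) → countFin R? ≡ 0 → ∀ x → ¬ R x
countFin≡0⇒none {m} {R} R? e x r =
  count≡0⇒none (atFin? R?) m e (toℕ x) (FP.toℕ<n x) (FP.toℕ<n x , subst R (sym (FP.fromℕ<-toℕ x (FP.toℕ<n x))) r)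

countFin≢0⇒some : {R : Fin m → Set} (R? : Decidable R) → ∀ {c} → countFin R? ≡ suc c → ∃ R
countFin≢0⇒some {m} R? e with count≢0⇒some (atFin? R?) m e
... | _ , _ , (k<m , r) = fromℕ< k<m , r

numCycles≡countFin : (π : Fin m → Fin m) → numCycles m π ≡ countFin (isCycleMin? π)
numCycles≡countFin π = length-filter-tabulate (isCycleMin? π) id

numCycles-cong : {π ρ : Fin m → Fin m} → (∀ x → π x ≡ ρ x) → numCycles m π ≡ numCycles m ρ
numCycles-cong {π = π} {ρ} π≗ρ = begin
  numCycles _ π             ≡⟨ numCycles≡countFin π ⟩
  countFin (isCycleMin? π)  ≡⟨ countFin-cong (isCycleMin? π) (isCycleMin? ρ) (λ x → transport (iter-cong π≗ρ))
                                                                              (λ x → transport (λ k y → sym (iter-cong π≗ρ k y))) ⟩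
  countFin (isCycleMin? ρ)  ≡⟨ numCycles≡countFin ρ ⟨
  numCycles _ ρ             ∎
  where
  open ≡-Reasoning
  transport : {f g : Fin _ → Fin _} {x : Fin _} → (∀ k y → iter f k y ≡ iter g k y) → IsCycleMin f x → IsCycleMin g x
  transport {x = x} e min k = subst (x Fin.≤_) (e (toℕ k) x) (min k)

numCycles≡countLeast : {π : Fin m → Fin m} (inj : Injective _≡_ _≡_ π) →
  numCycles m π ≡ countFin (isLeastInCycle? inj)
numCycles≡countLeast {π = π} inj = trans (numCycles≡countFin π)
  (countFin-cong (isCycleMin? π) (isLeastInCycle? inj) (λ _ → isCycleMin⇒isLeastInCycle inj) (λ _ → isLeastInCycle⇒isCycleMin))

countFin-singleton : {R : Fin m → Set} (R? : Decidable R) (w : Fin m) → R w → (∀ x → R x → x ≡ w) → countFin R? ≡ 1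
countFin-singleton {m} R? w rw only = trans
  (countFin-insert {R = λ (_ : Fin m) → ⊥} (λ _ → no λ ()) R? w (λ ()) (λ x r → inj₂ (only x r)) λ { x (inj₂ refl) → rw })
  (cong suc (countFin-none {R = λ (_ : Fin m) → ⊥} (λ _ → no λ ()) λ _ ()))

module CountShift {M N : ℕ} {π : Fin M → Fin M} {ρ : Fin N → Fin N}
                  (π-injective : Injective _≡_ _≡_ π) (ρ-injective : Injective _≡_ _≡_ ρ)
                  (c L : ℕ) (L≤N : L ≤ N) (c+L≤M : c + L ≤ M) (e : Fin N → Fin M)
                  (toℕ-e : ∀ x → toℕ x < L → toℕ (e x) ≡ c + toℕ x)
                  (ρ-below : ∀ x → toℕ x < L → toℕ (ρ x) < L)
                  (π∘e : ∀ x → toℕ x < L → π (e x) ≡ e (ρ x)) where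

  private
    Below : Fin N → Set
    Below x = toℕ x < L

    iter-e : ∀ k {x} → Below x → iter π k (e x) ≡ e (iter ρ k x)
    iter-e = iter-intertwine Below ρ-below e π∘e

    e-mono : ∀ {x y} → Below x → Below y → x Fin.≤ y → e x Fin.≤ e y
    e-mono {x} {y} bx by x≤y = subst₂ _≤_ (sym (toℕ-e x bx)) (sym (toℕ-e y by)) (ℕP.+-monoʳ-≤ c x≤y)

    e-mono⁻ : ∀ {x y} → Below x → Below y → e x Fin.≤ e y → x Fin.≤ y
    e-mono⁻ {x} {y} bx by ex≤ey = ℕP.+-cancelˡ-≤ c _ _ (subst₂ _≤_ (toℕ-e x bx) (toℕ-e y by) ex≤ey)

  least⇒least-e : ∀ {x} → Below x → IsLeastInCycle ρ x → IsLeastInCycle π (e x)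
  least⇒least-e bx least _ (k , refl) =
    subst (e _ Fin.≤_) (sym (iter-e k bx)) (e-mono bx (iter-preserves Below ρ-below k bx) (least _ (k , refl)))

  least-e⇒least : ∀ {x} → Below x → IsLeastInCycle π (e x) → IsLeastInCycle ρ x
  least-e⇒least bx least _ (k , refl) =
    e-mono⁻ bx (iter-preserves Below ρ-below k bx) (subst (e _ Fin.≤_) (iter-e k bx) (least _ (k , refl)))

  count-leastInCycle-shift : count (atFin? (isLeastInCycle? π-injective) ∘ (c +_)) L ≡ count (atFin? (isLeastInCycle? ρ-injective)) L
  count-leastInCycle-shift = count-cong _ _ L to from
    where
    at : ∀ {t} (t<L : t < L) → Fin N
    at t<L = fromℕ< (ℕP.<-≤-trans t<L L≤N)
    below-at : ∀ {t} (t<L : t < L) → Below (at t<L)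
    below-at t<L = subst (_< L) (sym (FP.toℕ-fromℕ< _)) t<L
    e-at : ∀ {t} (t<L : t < L) (h : c + t < M) → fromℕ< h ≡ e (at t<L)
    e-at t<L h = FP.toℕ-injective (trans (FP.toℕ-fromℕ< h)
                   (sym (trans (toℕ-e _ (below-at t<L)) (cong (c +_) (FP.toℕ-fromℕ< _)))))
    to : ∀ t → t < L → AtFin (IsLeastInCycle π) (c + t) → AtFin (IsLeastInCycle ρ) t
    to t t<L (h , least) = ℕP.<-≤-trans t<L L≤N ,
      least-e⇒least (below-at t<L) (subst (IsLeastInCycle π) (e-at t<L h) least)
    from : ∀ t → t < L → AtFin (IsLeastInCycle ρ) t → AtFin (IsLeastInCycle π) (c + t)
    from t t<L (_ , least) = h , subst (IsLeastInCycle π) (sym (e-at t<L h)) (least⇒least-e (below-at t<L) least)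
      where
      h : c + t < M
      h = ℕP.<-≤-trans (ℕP.+-monoʳ-< c t<L) c+L≤M

count-complement : (P? : Decidable P) → ∀ n → count P? n + count (¬? ∘ P?) n ≡ n
count-complement P? zero    = refl
count-complement P? (suc n) = begin
  (count P? n + indicator (P? n)) + (count (¬? ∘ P?) n + indicator (¬? (P? n)))
    ≡⟨ interchange (count P? n) _ _ _ ⟩
  (count P? n + count (¬? ∘ P?) n) + (indicator (P? n) + indicator (¬? (P? n)))
    ≡⟨ cong₂ _+_ (count-complement P? n) (indicator-¬ (P? n)) ⟩
  n + 1
    ≡⟨ ℕP.+-comm n 1 ⟩
  suc n ∎
  where
  open ≡-Reasoning
  indicator-¬ : {A : Set} (a? : Dec A) → indicator a? + indicator (¬? a?) ≡ 1
  indicator-¬ (yes _) = refl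
  indicator-¬ (no _)  = refl

countFin-complement : {R : Fin m → Set} (R? : Decidable R) → countFin R? + countFin (¬? ∘ R?) ≡ m
countFin-complement {m} {R} R? = trans (cong (countFin R? +_) (count-cong _ _ m to from)) (count-complement (atFin? R?) m)
  where
  to : ∀ k → k < m → AtFin (¬_ ∘ R) k → ¬ AtFin R k
  to k _ (_ , ¬r) (_ , r) = ¬r r
  from : ∀ k → k < m → ¬ AtFin R k → AtFin (¬_ ∘ R) k
  from k k<m ¬r = k<m , λ r → ¬r (k<m , r)

module _ (u v : Fin m) where

  transpose-ˡ : transpose u v u ≡ v
  transpose-ˡ with u FP.≟ u
  ... | yes _   = refl
  ... | no u≢u  = contradiction refl u≢u

  transpose-ʳ : transpose u v v ≡ u
  transpose-ʳ with v FP.≟ u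
  ... | yes v≡u = v≡u
  ... | no _ with v FP.≟ v
  ...   | yes _  = refl
  ...   | no v≢v = contradiction refl v≢v

  transpose-other : ∀ {w} → w ≢ u → w ≢ v → transpose u v w ≡ w
  transpose-other {w} w≢u w≢v with w FP.≟ u
  ... | yes w≡u = contradiction w≡u w≢u
  ... | no _ with w FP.≟ v
  ...   | yes w≡v = contradiction w≡v w≢v
  ...   | no _    = refl

  transpose-cases : ∀ w → (w ≡ u × transpose u v w ≡ v) ⊎ (w ≡ v × transpose u v w ≡ u) ⊎
                            (w ≢ u × w ≢ v × transpose u v w ≡ w)
  transpose-cases w with w FP.≟ u
  ... | yes w≡u = inj₁ (w≡u , refl)
  ... | no w≢u with w FP.≟ v
  ...   | yes w≡v = inj₂ (inj₁ (w≡v , refl))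
  ...   | no w≢v  = inj₂ (inj₂ (w≢u , w≢v , refl))

  transpose-involutive : ∀ w → transpose u v (transpose u v w) ≡ w
  transpose-involutive w with w FP.≟ u
  ... | yes refl = transpose-ʳ
  ... | no w≢u with w FP.≟ v
  ...   | yes refl = transpose-ˡ
  ...   | no w≢v   = transpose-other w≢u w≢v

  transpose-injective : Injective _≡_ _≡_ (transpose u v)
  transpose-injective {x} {y} e =
    trans (sym (transpose-involutive x)) (trans (cong (transpose u v) e) (transpose-involutive y))

iter-transpose-∘ : (π : Fin m → Fin m) (u v x : Fin m) → ∀ i →
  (∀ j → j < i → iter π (suc j) x ≢ u × iter π (suc j) x ≢ v) →
  iter (transpose u v ∘ π) i x ≡ iter π i x
iter-transpose-∘ π u v x zero    avoid = refl
iter-transpose-∘ π u v x (suc i) avoid =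
  trans (cong (transpose u v ∘ π) (iter-transpose-∘ π u v x i (λ j → avoid j ∘ ℕP.m<n⇒m<1+n)))
        (transpose-other u v (proj₁ (avoid i (ℕP.n<1+n i))) (proj₂ (avoid i (ℕP.n<1+n i))))

module Split {π : Fin m → Fin m} (inj : Injective _≡_ _≡_ π) {u v : Fin m} (u≢v : u ≢ v) (u~v : SameCycle π u v) where

  π′ : Fin m → Fin m
  π′ = transpose u v ∘ π

  π′-injective : Injective _≡_ _≡_ π′
  π′-injective = inj ∘ transpose-injective u v

  InC : Fin m → Set
  InC = SameCycle π u

  π′-preserves-C : ∀ w → InC w → InC (π′ w)
  π′-preserves-C w u~w with transpose-cases u v (π w)
  ... | inj₁ (_ , e)              = subst InC (sym e) u~v
  ... | inj₂ (inj₁ (_ , e))       = subst InC (sym e) sameCycle-refl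
  ... | inj₂ (inj₂ (_ , _ , e))   = subst InC (sym e) (sameCycle-trans u~w sameCycle-step)

  π′-cycle⊆C : ∀ {s x} → InC s → SameCycle π′ s x → InC x
  π′-cycle⊆C u~s (t , refl) = iter-preserves InC π′-preserves-C t u~s

  C⊆π′-cycles : ∀ {x} → InC x → SameCycle π′ u x ⊎ SameCycle π′ v x
  C⊆π′-cycles (t , refl) = iter-preserves Reached step t (inj₁ sameCycle-refl)
    where
    Reached : Fin m → Set
    Reached w = SameCycle π′ u w ⊎ SameCycle π′ v w
    step : ∀ w → Reached w → Reached (π w)
    step w r with transpose-cases u v (π w)
    ... | inj₁ (πw≡u , _)            = inj₁ (0 , sym πw≡u)
    ... | inj₂ (inj₁ (πw≡v , _))     = inj₂ (0 , sym πw≡v)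
    ... | inj₂ (inj₂ (_ , _ , π′w≡πw)) = Sum.map extend extend r
      where
      extend : ∀ {s} → SameCycle π′ s w → SameCycle π′ s (π w)
      extend s~w = subst (SameCycle π′ _) π′w≡πw (sameCycle-trans s~w sameCycle-step)

  -- The π′-cycle of u is the arc of C from u up to the first visit of v, closed up.
  π′-separates : ¬ SameCycle π′ u v
  π′-separates with least (λ k → iter π k u FP.≟ v) {proj₁ u~v} (proj₂ u~v)
  ... | zero  , πᵏu≡v , _     = contradiction πᵏu≡v u≢v
  ... | suc k , πᵏu≡v , first = λ (t , e) →
    first (t % suc k) (m%n<n t (suc k))
      (trans (sym (agree (ℕP.≤-pred (m%n<n t (suc k))))) (trans (sym (iter-%-period π′ᵏu≡u t)) e))
    where
    agree : ∀ {i} → i ≤ k → iter π′ i u ≡ iter π i u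
    agree {i} i≤k = iter-transpose-∘ π u v u i λ j j<i →
      let 1+j≤k = s≤s (ℕP.<-≤-trans j<i i≤k) in
      (λ e → first (suc k ∸ suc j) (ℕP.∸-monoʳ-< {suc k} {suc j} {0} ℕ.z<s (ℕP.<⇒≤ 1+j≤k)) (begin
         iter π (suc k ∸ suc j) u                      ≡⟨ cong (iter π (suc k ∸ suc j)) e ⟨
         iter π (suc k ∸ suc j) (iter π (suc j) u)     ≡⟨ iter-+ π (suc k ∸ suc j) (suc j) u ⟨
         iter π (suc k ∸ suc j + suc j) u              ≡⟨ cong (λ s → iter π s u) (ℕP.m∸n+n≡m (ℕP.<⇒≤ 1+j≤k)) ⟩
         iter π (suc k) u                              ≡⟨ πᵏu≡v ⟩
         v                                             ∎)) ,
      first (suc j) 1+j≤k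
      where open ≡-Reasoning
    π′ᵏu≡u : iter π′ (suc k) u ≡ u
    π′ᵏu≡u = trans (cong π′ (agree ℕP.≤-refl)) (trans (cong (transpose u v) πᵏu≡v) (transpose-ʳ u v))

  π′-agrees-outside-C : ∀ {x} → ¬ InC x → ∀ t → iter π′ t x ≡ iter π t x
  π′-agrees-outside-C {x} x∉C t = iter-transpose-∘ π u v x t λ j _ →
    let πʲ⁺¹x∉C = iter-preserves (¬_ ∘ InC) (λ w w∉C u~πw → w∉C (sameCycle-trans u~πw (sameCycle-sym inj sameCycle-step)))
                                 (suc j) x∉C in
    (λ e → πʲ⁺¹x∉C (subst InC (sym e) sameCycle-refl)) , (λ e → πʲ⁺¹x∉C (subst InC (sym e) u~v))

  least-outside-C : ∀ {x} → ¬ InC x → IsLeastInCycle π′ x → IsLeastInCycle π x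
  least-outside-C x∉C least y (t , e) = least y (t , trans (π′-agrees-outside-C x∉C t) e)

  least-outside-C′ : ∀ {x} → ¬ InC x → IsLeastInCycle π x → IsLeastInCycle π′ x
  least-outside-C′ x∉C least y (t , e) = least y (t , trans (sym (π′-agrees-outside-C x∉C t)) e)

  -- s₁ and s₂ are u and v in some order: the least element z of C lies on the π′-cycle of s₁,
  -- and the least element w of the π′-cycle of s₂ is the one new cycle minimum.
  module NewMinimum (s₁ s₂ : Fin m) (C⊆ : ∀ {x} → InC x → SameCycle π′ s₁ x ⊎ SameCycle π′ s₂ x)
                    (s₁∈C : InC s₁) (s₂∈C : InC s₂) (s₁≁s₂ : ¬ SameCycle π′ s₁ s₂)
                    {z : Fin m} (z-least : IsLeastInCycle π z) (s₁~z : SameCycle π′ s₁ z)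
                    {w : Fin m} (s₂~w : SameCycle π′ s₂ w) (w-least : IsLeastInCycle π′ w) where

    z∈C : InC z
    z∈C = π′-cycle⊆C s₁∈C s₁~z

    z-least′ : IsLeastInCycle π′ z
    z-least′ y z~y = z-least y (sameCycle-trans (sameCycle-sym inj z∈C) (π′-cycle⊆C z∈C z~y))

    new : ∀ x → IsLeastInCycle π′ x → IsLeastInCycle π x ⊎ x ≡ w
    new x x-least with sameCycle? inj u x
    ... | no x∉C = inj₁ (least-outside-C x∉C x-least)
    ... | yes x∈C with C⊆ x∈C
    ...   | inj₁ s₁~x = inj₁ (subst (IsLeastInCycle π) (leastInCycle-unique π′-injective z-least′ x-least
                                  (sameCycle-trans (sameCycle-sym π′-injective s₁~z) s₁~x)) z-least)
    ...   | inj₂ s₂~x = inj₂ (leastInCycle-unique π′-injective x-least w-least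
                                  (sameCycle-trans (sameCycle-sym π′-injective s₂~x) s₂~w))

    old : ∀ x → IsLeastInCycle π x ⊎ x ≡ w → IsLeastInCycle π′ x
    old x (inj₂ refl) = w-least
    old x (inj₁ x-least) with sameCycle? inj u x
    ... | no x∉C  = least-outside-C′ x∉C x-least
    ... | yes x∈C = subst (IsLeastInCycle π′)
                      (leastInCycle-unique inj z-least x-least (sameCycle-trans (sameCycle-sym inj z∈C) x∈C)) z-least′

    w-not-least : ¬ IsLeastInCycle π w
    w-not-least w-least′ with leastInCycle-unique inj w-least′ z-least
                                (sameCycle-trans (sameCycle-sym inj (π′-cycle⊆C s₂∈C s₂~w)) z∈C)
    ... | refl = s₁≁s₂ (sameCycle-trans s₁~z (sameCycle-sym π′-injective s₂~w))

    numCycles-π′ : numCycles m π′ ≡ suc (numCycles m π)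
    numCycles-π′ = begin
      numCycles m π′                          ≡⟨ numCycles≡countLeast π′-injective ⟩
      countFin (isLeastInCycle? π′-injective) ≡⟨ countFin-insert (isLeastInCycle? inj) (isLeastInCycle? π′-injective) w w-not-least new old ⟩
      suc (countFin (isLeastInCycle? inj))    ≡⟨ cong suc (numCycles≡countLeast inj) ⟨
      suc (numCycles m π)                     ∎
      where open ≡-Reasoning

  numCycles-split : numCycles m π′ ≡ suc (numCycles m π)
  numCycles-split with leastInCycle inj u
  ... | z , u~z , z-least with C⊆π′-cycles u~z
  ...   | inj₁ u~′z = let (w , v~w , w-least) = leastInCycle π′-injective v in
    NewMinimum.numCycles-π′ u v C⊆π′-cycles sameCycle-refl u~v π′-separates z-least u~′z v~w w-least
  ...   | inj₂ v~′z = let (w , u~w , w-least) = leastInCycle π′-injective u in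
    NewMinimum.numCycles-π′ v u (Sum.swap ∘ C⊆π′-cycles) u~v sameCycle-refl
      (π′-separates ∘ sameCycle-sym π′-injective) z-least v~′z u~w w-least

numCycles-transpose-split : {π : Fin m → Fin m} → Injective _≡_ _≡_ π → ∀ {u v} → u ≢ v →
  SameCycle π u v → numCycles m (transpose u v ∘ π) ≡ suc (numCycles m π)
numCycles-transpose-split inj u≢v u~v = Split.numCycles-split inj u≢v u~v

-- Walking the π-cycle of u back to u, transpose u v ∘ π is diverted to v at the last step.
transpose-joins : {π : Fin m → Fin m} → Injective _≡_ _≡_ π → ∀ {u v} →
  ¬ SameCycle π u v → SameCycle (transpose u v ∘ π) u v
transpose-joins {π = π} inj {u} {v} u≁v with period inj u
... | suc d , _ , _ , πᵈu≡u with least (λ k → iter π (suc k) u FP.≟ u) {d} πᵈu≡u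
...   | k , πᵏ⁺¹u≡u , first = suc k , (begin
  transpose u v (π (iter (transpose u v ∘ π) k u))
    ≡⟨ cong (transpose u v ∘ π) (iter-transpose-∘ π u v u k λ j j<k → first j j<k , (λ e → u≁v (suc j , e))) ⟩
  transpose u v (iter π (suc k) u)  ≡⟨ cong (transpose u v) πᵏ⁺¹u≡u ⟩
  transpose u v u                   ≡⟨ transpose-ˡ u v ⟩
  v                                 ∎)
  where open ≡-Reasoning

numCycles-transpose-merge : {π : Fin m → Fin m} → Injective _≡_ _≡_ π → ∀ {u v} → u ≢ v →
  ¬ SameCycle π u v → suc (numCycles m (transpose u v ∘ π)) ≡ numCycles m π
numCycles-transpose-merge {m} {π} inj {u} {v} u≢v u≁v = begin
  suc (numCycles m (transpose u v ∘ π))                  ≡⟨ numCycles-transpose-split π′-injective u≢v (transpose-joins inj u≁v) ⟨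
  numCycles m (transpose u v ∘ transpose u v ∘ π)        ≡⟨ numCycles-cong (transpose-involutive u v ∘ π) ⟩
  numCycles m π                                          ∎
  where
  open ≡-Reasoning
  π′-injective : Injective _≡_ _≡_ (transpose u v ∘ π)
  π′-injective = inj ∘ transpose-injective u v

involutive⇒injective : {β : Fin m → Fin m} → Involutive _≡_ β → Injective _≡_ _≡_ β
involutive⇒injective {β = β} inv {x} {y} e = trans (sym (inv x)) (trans (cong β e) (inv y))

numPairs : (Fin m → Fin m) → ℕ
numPairs β = countFin (λ x → x Fin.<? β x)

numFixed : (Fin m → Fin m) → ℕ
numFixed β = countFin (λ x → β x FP.≟ x)

numPairs≡0⇒identity : {β : Fin m → Fin m} → Involutive _≡_ β → numPairs β ≡ 0 → ∀ x → β x ≡ x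
numPairs≡0⇒identity {β = β} inv none x with FP.<-cmp x (β x)
... | tri< x<βx _ _ = contradiction x<βx (countFin≡0⇒none _ none x)
... | tri≈ _ x≡βx _ = sym x≡βx
... | tri> _ _ βx<x = contradiction (subst (β x Fin.<_) (sym (inv x)) βx<x) (countFin≡0⇒none _ none (β x))

module RemovePair {β : Fin m → Fin m} (inv : Involutive _≡_ β) {x : Fin m} (x<βx : x Fin.< β x) where

  τ : Fin m → Fin m
  τ = transpose x (β x)

  β′ : Fin m → Fin m
  β′ = τ ∘ β

  x≢βx : x ≢ β x
  x≢βx = FP.<⇒≢ x<βx

  β-cases : ∀ z → (z ≡ x × β′ z ≡ z) ⊎ (z ≡ β x × β′ z ≡ z) ⊎ (z ≢ x × z ≢ β x × β′ z ≡ β z)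
  β-cases z with transpose-cases x (β x) (β z)
  ... | inj₁ (βz≡x , e) = inj₂ (inj₁ (z≡βx , trans e (sym z≡βx)))
    where
    z≡βx : z ≡ β x
    z≡βx = trans (sym (inv z)) (cong β βz≡x)
  ... | inj₂ (inj₁ (βz≡βx , e)) = inj₁ (z≡x , trans e (sym z≡x))
    where
    z≡x : z ≡ x
    z≡x = involutive⇒injective inv βz≡βx
  ... | inj₂ (inj₂ (βz≢x , βz≢βx , e)) =
    inj₂ (inj₂ ((λ z≡x → βz≢βx (cong β z≡x)) , (λ z≡βx → βz≢x (trans (cong β z≡βx) (inv x))) , e))

  β≗τ∘β′ : ∀ z → β z ≡ τ (β′ z)
  β≗τ∘β′ z = sym (transpose-involutive x (β x) (β z))

  β′-involutive : Involutive _≡_ β′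
  β′-involutive z with β-cases z
  ... | inj₁ (_ , e)              = trans (cong β′ e) e
  ... | inj₂ (inj₁ (_ , e))       = trans (cong β′ e) e
  ... | inj₂ (inj₂ (z≢x , z≢βx , e)) with β-cases (β z)
  ...   | inj₁ (βz≡x , _)          = contradiction (trans (sym (inv z)) (cong β βz≡x)) z≢βx
  ...   | inj₂ (inj₁ (βz≡βx , _))  = contradiction (involutive⇒injective inv βz≡βx) z≢x
  ...   | inj₂ (inj₂ (_ , _ , e′)) = trans (cong β′ e) (trans e′ (inv z))

  β′-x : β′ x ≡ x
  β′-x = transpose-ʳ x (β x)

  β′-βx : β′ (β x) ≡ β x
  β′-βx = trans (cong τ (inv x)) (transpose-ˡ x (β x))

  numPairs-β : numPairs β ≡ suc (numPairs β′)
  numPairs-β = countFin-insert (λ z → z Fin.<? β′ z) (λ z → z Fin.<? β z) x (FP.<-irrefl (sym β′-x)) new old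
    where
    new : ∀ z → z Fin.< β z → z Fin.< β′ z ⊎ z ≡ x
    new z z<βz with β-cases z
    ... | inj₁ (z≡x , _)                = inj₂ z≡x
    ... | inj₂ (inj₁ (refl , _))        = contradiction (subst (β x Fin.<_) (inv x) z<βz) (FP.<-asym x<βx)
    ... | inj₂ (inj₂ (_ , _ , β′z≡βz))  = inj₁ (subst (z Fin.<_) (sym β′z≡βz) z<βz)
    old : ∀ z → z Fin.< β′ z ⊎ z ≡ x → z Fin.< β z
    old z (inj₂ refl) = x<βx
    old z (inj₁ z<β′z) with β-cases z
    ... | inj₁ (refl , _)               = x<βx
    ... | inj₂ (inj₁ (_ , β′z≡z))       = contradiction (sym β′z≡z) (FP.<⇒≢ z<β′z)
    ... | inj₂ (inj₂ (_ , _ , β′z≡βz))  = subst (z Fin.<_) β′z≡βz z<β′z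

  numFixed-β′ : numFixed β′ ≡ suc (suc (numFixed β))
  numFixed-β′ = trans
    (countFin-insert fixedOrβx? (λ z → β′ z FP.≟ z) x x-new new old)
    (cong suc (countFin-insert (λ z → β z FP.≟ z) fixedOrβx? (β x) (x≢βx ∘ trans (sym (inv x))) (λ _ → id) (λ _ → id)))
    where
    fixedOrβx? : Decidable (λ z → β z ≡ z ⊎ z ≡ β x)
    fixedOrβx? = λ z → (β z FP.≟ z) ⊎-dec (z FP.≟ β x)
    x-new : ¬ (β x ≡ x ⊎ x ≡ β x)
    x-new (inj₁ βx≡x) = x≢βx (sym βx≡x)
    x-new (inj₂ x≡βx) = x≢βx x≡βx
    new : ∀ z → β′ z ≡ z → (β z ≡ z ⊎ z ≡ β x) ⊎ z ≡ x
    new z β′z≡z with β-cases z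
    ... | inj₁ (z≡x , _)                = inj₂ z≡x
    ... | inj₂ (inj₁ (z≡βx , _))        = inj₁ (inj₂ z≡βx)
    ... | inj₂ (inj₂ (_ , _ , β′z≡βz))  = inj₁ (inj₁ (trans (sym β′z≡βz) β′z≡z))
    old : ∀ z → (β z ≡ z ⊎ z ≡ β x) ⊎ z ≡ x → β′ z ≡ z
    old z (inj₂ refl)        = β′-x
    old z (inj₁ (inj₂ refl)) = β′-βx
    old z (inj₁ (inj₁ βz≡z)) with β-cases z
    ... | inj₁ (_ , β′z≡z)              = β′z≡z
    ... | inj₂ (inj₁ (_ , β′z≡z))       = β′z≡z
    ... | inj₂ (inj₂ (_ , _ , β′z≡βz))  = trans β′z≡βz βz≡z

  β′∘-injective : {π : Fin m → Fin m} → Injective _≡_ _≡_ π → Injective _≡_ _≡_ (β′ ∘ π)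
  β′∘-injective inj = inj ∘ involutive⇒injective {β = β′} β′-involutive

  numCycles-β∘π : {π : Fin m → Fin m} → Injective _≡_ _≡_ π → ∀ {N e} →
    numCycles m (β′ ∘ π) + 2 * e ≡ numCycles m π + N → ∃ λ e′ → numCycles m (β ∘ π) + 2 * e′ ≡ numCycles m π + suc N
  numCycles-β∘π {π} inj {N} {e} IH with sameCycle? (β′∘-injective inj) x (β x)
  ... | yes x~βx = e , (begin
    numCycles m (β ∘ π) + 2 * e          ≡⟨ cong (_+ 2 * e) (trans (numCycles-cong (β≗τ∘β′ ∘ π))
                                                                    (numCycles-transpose-split (β′∘-injective inj) x≢βx x~βx)) ⟩
    suc (numCycles m (β′ ∘ π) + 2 * e)   ≡⟨ cong suc IH ⟩
    suc (numCycles m π + N)              ≡⟨ ℕP.+-suc _ N ⟨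
    numCycles m π + suc N                ∎)
    where open ≡-Reasoning
  ... | no x≁βx = suc e , ℕP.suc-injective (begin
    suc (numCycles m (β ∘ π) + 2 * suc e)          ≡⟨ cong (λ t → suc (numCycles m (β ∘ π) + t)) (ℕP.*-suc 2 e) ⟩
    suc (numCycles m (β ∘ π) + suc (suc (2 * e)))  ≡⟨ cong suc (ℕP.+-suc _ (suc (2 * e))) ⟩
    suc (suc (numCycles m (β ∘ π) + suc (2 * e)))  ≡⟨ cong (suc ∘ suc) (ℕP.+-suc _ (2 * e)) ⟩
    suc (suc (suc (numCycles m (β ∘ π) + 2 * e)))  ≡⟨ cong (λ t → suc (suc (t + 2 * e))) (trans (cong suc (numCycles-cong (β≗τ∘β′ ∘ π)))
                                                                          (numCycles-transpose-merge (β′∘-injective inj) x≢βx x≁βx)) ⟩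
    suc (suc (numCycles m (β′ ∘ π) + 2 * e))       ≡⟨ cong (suc ∘ suc) IH ⟩
    suc (suc (numCycles m π + N))                  ≡⟨ cong suc (ℕP.+-suc _ N) ⟨
    suc (numCycles m π + suc N)                    ∎)
    where open ≡-Reasoning

twice-numPairs+numFixed : (β : Fin m → Fin m) → Involutive _≡_ β → ∀ N → numPairs β ≡ N → 2 * N + numFixed β ≡ m
twice-numPairs+numFixed β inv zero    none = countFin-all _ (numPairs≡0⇒identity inv none)
twice-numPairs+numFixed {m} β inv (suc N) e with countFin≢0⇒some (λ x → x Fin.<? β x) e
... | x , x<βx = begin
  2 * suc N + numFixed β          ≡⟨ cong (_+ numFixed β) (ℕP.*-suc 2 N) ⟩
  2 + 2 * N + numFixed β          ≡⟨ cong (_+ numFixed β) (ℕP.+-comm 2 (2 * N)) ⟩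
  2 * N + 2 + numFixed β          ≡⟨ ℕP.+-assoc (2 * N) 2 _ ⟩
  2 * N + suc (suc (numFixed β))  ≡⟨ cong (2 * N +_) numFixed-β′ ⟨
  2 * N + numFixed β′             ≡⟨ twice-numPairs+numFixed β′ β′-involutive N (ℕP.suc-injective (trans (sym numPairs-β) e)) ⟩
  m                               ∎
  where
  open ≡-Reasoning
  open RemovePair {β = β} inv {x} x<βx

numCycles-involution-∘ : (β : Fin m → Fin m) → Involutive _≡_ β → ∀ N → numPairs β ≡ N →
  {π : Fin m → Fin m} → Injective _≡_ _≡_ π → ∃ λ e → numCycles m (β ∘ π) + 2 * e ≡ numCycles m π + N
numCycles-involution-∘ β inv zero none {π} inj =
  0 , trans (ℕP.+-identityʳ _) (trans (numCycles-cong (numPairs≡0⇒identity inv none ∘ π)) (sym (ℕP.+-identityʳ _)))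
numCycles-involution-∘ β inv (suc N) e inj with countFin≢0⇒some (λ x → x Fin.<? β x) e
... | x , x<βx = let (e′ , IH) = numCycles-involution-∘ β′ β′-involutive N (ℕP.suc-injective (trans (sym numPairs-β) e)) inj
                 in numCycles-β∘π inj {e = e′} IH
  where open RemovePair {β = β} inv {x} x<βx

-- α restricted to S and extended by the identity is an involution whose fixed points are the complement of S.
invariant-even : (α : Fin m → Fin m) → Involutive _≡_ α → (∀ x → α x ≢ x) →
  {S : Fin m → Set} (S? : Decidable S) → (∀ x → S x → S (α x)) → ∃ λ N → 2 * N ≡ countFin S?
invariant-even {m} α inv fpf {S} S? α-preserves-S = numPairs β , ℕP.+-cancelʳ-≡ (countFin (¬? ∘ S?)) _ _ (begin
  2 * numPairs β + countFin (¬? ∘ S?)   ≡⟨ cong (2 * numPairs β +_) (countFin-cong _ _ outside⇒fixed fixed⇒outside) ⟩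
  2 * numPairs β + numFixed β           ≡⟨ twice-numPairs+numFixed β β-involutive (numPairs β) refl ⟩
  m                                     ≡⟨ countFin-complement S? ⟨
  countFin S? + countFin (¬? ∘ S?)      ∎)
  where
  open ≡-Reasoning
  β : Fin m → Fin m
  β x with S? x
  ... | yes _ = α x
  ... | no  _ = x
  β-in : ∀ {x} → S x → β x ≡ α x
  β-in {x} s with S? x
  ... | yes _ = refl
  ... | no ¬s = contradiction s ¬s
  β-out : ∀ {x} → ¬ S x → β x ≡ x
  β-out {x} ¬s with S? x
  ... | yes s = contradiction s ¬s
  ... | no _  = refl
  β-involutive : Involutive _≡_ β
  β-involutive x with S? x
  ... | yes s = trans (β-in (α-preserves-S x s)) (inv x)
  ... | no ¬s = β-out ¬s
  outside⇒fixed : ∀ x → ¬ S x → β x ≡ x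
  outside⇒fixed x = β-out
  fixed⇒outside : ∀ x → β x ≡ x → ¬ S x
  fixed⇒outside x βx≡x s = fpf x (trans (sym (β-in s)) βx≡x)

toℕ-p : ∀ n → toℕ (p n) ≡ suc (2 * n)
toℕ-p n = FP.toℕ-fromℕ (suc (2 * n))

toℕ-γ : ∀ n {x : H n} → toℕ x < suc (2 * n) → toℕ (γ n x) ≡ suc (toℕ x)
toℕ-γ n x<p = trans (FP.toℕ-fromℕ< _) (m<n⇒m%n≡m (s≤s x<p))

γ-p : ∀ n → γ n (p n) ≡ r n
γ-p n = FP.toℕ-injective (trans (FP.toℕ-fromℕ< _) (trans (cong (λ t → suc t % size n) (toℕ-p n)) (n%n≡0 (size n))))

below-p-or-p : ∀ n (x : H n) → toℕ x < suc (2 * n) ⊎ x ≡ p n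
below-p-or-p n x with ℕP.m≤n⇒m<n∨m≡n (ℕP.≤-pred (FP.toℕ<n x))
... | inj₁ x<p = inj₁ x<p
... | inj₂ x≡p = inj₂ (FP.toℕ-injective (trans x≡p (sym (toℕ-p n))))

γ-injective : ∀ n → Injective _≡_ _≡_ (γ n)
γ-injective n {x} {y} e with below-p-or-p n x | below-p-or-p n y
... | inj₁ x<p  | inj₁ y<p  = FP.toℕ-injective (ℕP.suc-injective (trans (sym (toℕ-γ n x<p)) (trans (cong toℕ e) (toℕ-γ n y<p))))
... | inj₂ refl | inj₂ refl = refl
... | inj₁ x<p  | inj₂ refl = contradiction (trans (sym (toℕ-γ n x<p)) (cong toℕ (trans e (γ-p n)))) λ ()
... | inj₂ refl | inj₁ y<p  = contradiction (trans (sym (toℕ-γ n y<p)) (cong toℕ (trans (sym e) (γ-p n)))) λ ()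

toℕ-iter-γ-r : ∀ n k → k < size n → toℕ (iter (γ n) k (r n)) ≡ k
toℕ-iter-γ-r n zero    _       = refl
toℕ-iter-γ-r n (suc k) 1+k<s = trans (toℕ-γ n (subst (_< suc (2 * n)) (sym IH) (ℕP.≤-pred 1+k<s))) (cong suc IH)
  where
  IH : toℕ (iter (γ n) k (r n)) ≡ k
  IH = toℕ-iter-γ-r n k (ℕP.<-trans (ℕP.n<1+n k) 1+k<s)

numCycles-γ : ∀ n → numCycles (size n) (γ n) ≡ 1
numCycles-γ n = trans (numCycles≡countLeast (γ-injective n))
  (countFin-singleton (isLeastInCycle? (γ-injective n)) (r n) (λ _ _ → z≤n) least⇒r)
  where
  r~ : ∀ x → SameCycle (γ n) (r n) x
  r~ x = toℕ x , FP.toℕ-injective (toℕ-iter-γ-r n (toℕ x) (FP.toℕ<n x))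
  least⇒r : ∀ x → IsLeastInCycle (γ n) x → x ≡ r n
  least⇒r x least = FP.toℕ-injective (ℕP.n≤0⇒n≡0 (least (r n) (sameCycle-sym (γ-injective n) (r~ x))))

∃-genus : ∀ n (α : H n → H n) → Involutive _≡_ α → (∀ x → α x ≢ x) → ∃ λ g → numCycles (size n) (σ n α) + 2 * g ≡ n + 2
∃-genus n α inv fpf with numCycles-involution-∘ α inv (numPairs α) refl (γ-injective n)
... | g , V+2g≡1+pairs = g , trans V+2g≡1+pairs (trans (cong₂ _+_ (numCycles-γ n) numPairs≡1+n) (ℕP.+-comm 2 n))
  where
  numPairs≡1+n : numPairs α ≡ suc n
  numPairs≡1+n = ℕP.*-cancelˡ-≡ _ _ 2 (begin
    2 * numPairs α                ≡⟨ ℕP.+-identityʳ _ ⟨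
    2 * numPairs α + 0            ≡⟨ cong (2 * numPairs α +_) (countFin-none _ fpf) ⟨
    2 * numPairs α + numFixed α   ≡⟨ twice-numPairs+numFixed α inv (numPairs α) refl ⟩
    size n                        ≡⟨ ℕP.*-suc 2 n ⟨
    2 * suc n                     ∎)
    where open ≡-Reasoning

module _ (n : ℕ) (α : H n → H n) (inv : Involutive _≡_ α) (root : α (r n) ≡ p n) where

  σ-injective : Injective _≡_ _≡_ (σ n α)
  σ-injective = γ-injective n ∘ involutive⇒injective {β = α} inv

  σ-p : σ n α (p n) ≡ p n
  σ-p = trans (cong α (γ-p n)) root

  σ-below-p : ∀ {x} → toℕ x < suc (2 * n) → toℕ (σ n α x) < suc (2 * n)
  σ-below-p {x} x<p with below-p-or-p n (σ n α x)
  ... | inj₁ σx<p = σx<p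
  ... | inj₂ σx≡p = contradiction (subst (λ y → toℕ y < suc (2 * n)) (σ-injective (trans σx≡p (sym σ-p))) x<p)
                                  (ℕP.<-irrefl (toℕ-p n))

numCycles-σ≡countBelow-p+1 : ∀ m (β : H m → H m) (inv : Involutive _≡_ β) (root : β (r m) ≡ p m) →
  numCycles (size m) (σ m β) ≡ count (atFin? (isLeastInCycle? (σ-injective m β inv root))) (suc (2 * m)) + 1
numCycles-σ≡countBelow-p+1 m β inv root = trans (numCycles≡countLeast (σ-injective m β inv root))
  (cong (count least? (suc (2 * m)) +_) (indicator-yes (least? (suc (2 * m))) (ℕP.n<1+n _ , p-least)))
  where
  least? : Decidable (AtFin (IsLeastInCycle (σ m β)))
  least? = atFin? (isLeastInCycle? (σ-injective m β inv root))
  p-least : IsLeastInCycle (σ m β) (fromℕ< (ℕP.n<1+n (suc (2 * m))))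
  p-least = subst (IsLeastInCycle (σ m β)) (FP.toℕ-injective (trans (toℕ-p m) (sym (FP.toℕ-fromℕ< (ℕP.n<1+n (suc (2 * m)))))))
                  (fixedPoint⇒isLeastInCycle (σ-p m β inv root))

record IsPlanted (n : ℕ) (α : H n → H n) : Set where
  field
    involutive     : Involutive _≡_ α
    fixedPointFree : ∀ x → α x ≢ x
    root           : α (r n) ≡ p n

isPlanted : ∀ {g n} {α : H n → H n} → IsU g n α → IsPlanted n α
isPlanted isU = record { involutive = IsU.involution isU ; fixedPointFree = IsU.fixedPointFree isU ; root = IsU.root isU }

α-p : ∀ {n} {α : H n → H n} → IsPlanted n α → α (p n) ≡ r n
α-p {α = α} planted = trans (cong α (sym (IsPlanted.root planted))) (IsPlanted.involutive planted _)

toℕ-mod : ∀ {t N} → t < suc N → toℕ (t mod suc N) ≡ t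
toℕ-mod t<N = trans (FP.toℕ-fromℕ< _) (m<n⇒m%n≡m t<N)

size-+ : ∀ j k → suc (suc (2 * suc (j + k))) ≡ suc (suc (2 * j)) + suc (suc (2 * k))
size-+ = solve-∀

toℕ+[n∸toℕ]≡n : ∀ {n} (j : Fin (suc n)) → toℕ j + (n ∸ toℕ j) ≡ n
toℕ+[n∸toℕ]≡n j = ℕP.m+[n∸m]≡n (ℕP.≤-pred (FP.toℕ<n j))

InBlock : ∀ {m} → ℕ → Fin m → Set
InBlock c x = 0 < toℕ x × toℕ x ≤ c

inBlock? : ∀ {m} (c : ℕ) → Decidable (InBlock {m} c)
inBlock? c x = (0 <? toℕ x) ×-dec (toℕ x ≤? c)

countFin-inBlock : ∀ {m} c → c < m → countFin (inBlock? {m} c) ≡ c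
countFin-inBlock {suc m} c (s≤s c≤m) = begin
  count P? (suc m)                                   ≡⟨ cong (count P? ∘ suc) (ℕP.m+[n∸m]≡n c≤m) ⟨
  count P? (1 + (c + (m ∸ c)))                       ≡⟨ count-+ P? 1 (c + (m ∸ c)) ⟩
  count P? 1 + count (P? ∘ (1 +_)) (c + (m ∸ c))     ≡⟨ cong (count P? 1 +_) (count-+ (P? ∘ (1 +_)) c (m ∸ c)) ⟩
  count P? 1 + (count (P? ∘ (1 +_)) c + count (P? ∘ (1 +_) ∘ (c +_)) (m ∸ c))
    ≡⟨ cong₂ _+_ (count-none P? 1 λ { 0 _ (_ , () , _) ; (suc _) (s≤s ()) _ })
                 (cong₂ _+_ (count-all _ c λ t t<c → s≤s (ℕP.<-≤-trans t<c c≤m) ,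
                                                      ℕ.z<s , subst (_≤ c) (sym (FP.toℕ-fromℕ< (s≤s (ℕP.<-≤-trans t<c c≤m)))) t<c)
                            (count-none _ (m ∸ c) λ t _ (h , _ , ≤c) →
                               ℕP.<-irrefl refl (ℕP.<-≤-trans (s≤s (ℕP.m≤m+n c t)) (subst (_≤ c) (FP.toℕ-fromℕ< h) ≤c)))) ⟩
  0 + (c + 0)                                        ≡⟨ ℕP.+-identityʳ c ⟩
  c                                                  ∎
  where
  open ≡-Reasoning
  P? : Decidable (AtFin (InBlock {suc m} c))
  P? = atFin? (inBlock? {suc m} c)

genus-+ : ∀ V VA VB G₁ G₂ j k → V + 1 ≡ VA + VB → VA + 2 * G₁ ≡ j + 2 → VB + 2 * G₂ ≡ k + 2 →
  V + 2 * (G₁ + G₂) ≡ suc (j + k) + 2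
genus-+ V VA VB G₁ G₂ j k V+1≡ A≡ B≡ = ℕP.suc-injective (begin
  suc (V + 2 * (G₁ + G₂))                ≡⟨ shift-1 V (G₁ + G₂) ⟩
  (V + 1) + 2 * (G₁ + G₂)                ≡⟨ cong (_+ 2 * (G₁ + G₂)) V+1≡ ⟩
  (VA + VB) + 2 * (G₁ + G₂)              ≡⟨ cong ((VA + VB) +_) (ℕP.*-distribˡ-+ 2 G₁ G₂) ⟩
  (VA + VB) + (2 * G₁ + 2 * G₂)          ≡⟨ interchange VA VB (2 * G₁) (2 * G₂) ⟩
  (VA + 2 * G₁) + (VB + 2 * G₂)          ≡⟨ cong₂ _+_ A≡ B≡ ⟩
  (j + 2) + (k + 2)                      ≡⟨ collect j k ⟩
  suc (suc (j + k) + 2)                  ∎)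
  where
  open ≡-Reasoning
  shift-1 : ∀ V G → suc (V + 2 * G) ≡ (V + 1) + 2 * G
  shift-1 = solve-∀
  collect : ∀ j k → (j + 2) + (k + 2) ≡ suc (suc (j + k) + 2)
  collect = solve-∀

Nested : ∀ n → (H (suc n) → H (suc n)) → Set
Nested n α = ∀ x → one n Fin.< x → x Fin.< α (one n) → α x Fin.< α (one n)

TypeIII : ∀ n → (H (suc n) → H (suc n)) → Set
TypeIII n α = ¬ SameCycle (σ (suc n) α) (one n) (α (one n)) × Nested n α

-- H (n+1) = {r} ∪ A ∪ B′ with A = {1, …, 2j+2} a copy of H j shifted by one and
-- B′ = {2j+3, …, 2n+3}, so that {r} ∪ B′ is a copy of H k with r fixed and the rest shifted by 2j+2.
module Layout (n j k : ℕ) (j+k≡n : j + k ≡ n) where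

  a : ℕ
  a = size j

  size-split : size (suc n) ≡ a + size k
  size-split = trans (cong (size ∘ suc) (sym j+k≡n)) (size-+ j k)

  a<size : a < size (suc n)
  a<size = subst (a <_) (sym size-split) (ℕP.m<m+n a ℕ.z<s)

  InA : H (suc n) → Set
  InA = InBlock a

  inA? : Decidable InA
  inA? = inBlock? a

  eA : H j → H (suc n)
  eA i = suc (toℕ i) mod size (suc n)

  toℕ-eA : ∀ i → toℕ (eA i) ≡ suc (toℕ i)
  toℕ-eA i = toℕ-mod (ℕP.≤-<-trans (FP.toℕ<n i) a<size)

  dA : H (suc n) → H j
  dA x = (toℕ x ∸ 1) mod a

  shiftB : ℕ → ℕ
  shiftB zero    = 0
  shiftB (suc t) = a + suc t

  unshiftB : ℕ → ℕ
  unshiftB zero    = 0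
  unshiftB (suc t) = suc t ∸ a

  eB : H k → H (suc n)
  eB i = shiftB (toℕ i) mod size (suc n)

  toℕ-eB : ∀ i → toℕ (eB i) ≡ shiftB (toℕ i)
  toℕ-eB i = toℕ-mod (shiftB< (toℕ i) (FP.toℕ<n i))
    where
    shiftB< : ∀ t → t < size k → shiftB t < size (suc n)
    shiftB< zero    _   = ℕ.z<s
    shiftB< (suc t) t<k = subst (a + suc t <_) (sym size-split) (ℕP.+-monoʳ-< a t<k)

  inA-eA : ∀ i → InA (eA i)
  inA-eA i = subst (0 <_) (sym (toℕ-eA i)) ℕ.z<s , subst (_≤ a) (sym (toℕ-eA i)) (FP.toℕ<n i)

  dB : H (suc n) → H k
  dB x = unshiftB (toℕ x) mod size k

  toℕ-dA : ∀ x → InA x → toℕ (dA x) ≡ toℕ x ∸ 1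
  toℕ-dA x (0<x , x≤a) = toℕ-mod (subst (_≤ a) (sym (ℕP.m+[n∸m]≡n 0<x)) x≤a)

  dA-eA : ∀ i → dA (eA i) ≡ i
  dA-eA i = FP.toℕ-injective (trans (toℕ-dA (eA i) (inA-eA i)) (cong (_∸ 1) (toℕ-eA i)))

  eA-dA : ∀ x → InA x → eA (dA x) ≡ x
  eA-dA x inA@(0<x , _) = FP.toℕ-injective (trans (toℕ-eA (dA x)) (trans (cong suc (toℕ-dA x inA)) (ℕP.m+[n∸m]≡n 0<x)))

  unshiftB-shiftB : ∀ t → unshiftB (shiftB t) ≡ t
  unshiftB-shiftB zero    = refl
  unshiftB-shiftB (suc t) = ℕP.m+n∸m≡n a (suc t)

  shiftB-unshiftB : ∀ t → t ≡ 0 ⊎ a < t → shiftB (unshiftB t) ≡ t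
  shiftB-unshiftB zero    _                 = refl
  shiftB-unshiftB (suc t) (inj₂ (s≤s a≤t)) = begin
    shiftB (suc t ∸ a)     ≡⟨ cong shiftB (ℕP.+-∸-assoc 1 a≤t) ⟩
    a + suc (t ∸ a)        ≡⟨ ℕP.+-suc a (t ∸ a) ⟩
    suc (a + (t ∸ a))      ≡⟨ cong suc (ℕP.m+[n∸m]≡n a≤t) ⟩
    suc t                  ∎
    where open ≡-Reasoning

  outside-A : ∀ x → ¬ InA x → toℕ x ≡ 0 ⊎ a < toℕ x
  outside-A x x∉A with 0 <? toℕ x | toℕ x ≤? a
  ... | no 0≮x  | _       = inj₁ (ℕP.n≤0⇒n≡0 (ℕP.≮⇒≥ 0≮x))
  ... | yes 0<x | yes x≤a = contradiction (0<x , x≤a) x∉A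
  ... | yes _   | no x≰a  = inj₂ (ℕP.≰⇒> x≰a)

  ¬inA-eB : ∀ i → ¬ InA (eB i)
  ¬inA-eB i (0<x , x≤a) with toℕ i | toℕ-eB i
  ... | zero  | e = ℕP.<-irrefl (sym e) 0<x
  ... | suc t | e = ℕP.<-irrefl refl (ℕP.<-≤-trans (ℕP.m<m+n a ℕ.z<s) (subst (_≤ a) e x≤a))

  toℕ-dB : ∀ x → ¬ InA x → toℕ (dB x) ≡ unshiftB (toℕ x)
  toℕ-dB x x∉A with outside-A x x∉A
  ... | inj₁ x≡0 = toℕ-mod (subst (λ t → unshiftB t < size k) (sym x≡0) ℕ.z<s)
  ... | inj₂ a<x = toℕ-mod (subst (_< size k) (sym (unshiftB≡∸ a<x))
                             (ℕP.m<n+o⇒m∸n<o (toℕ x) a (subst (toℕ x <_) size-split (FP.toℕ<n x))))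
    where
    unshiftB≡∸ : ∀ {t} → a < t → unshiftB t ≡ t ∸ a
    unshiftB≡∸ {suc t} _ = refl

  dB-eB : ∀ i → dB (eB i) ≡ i
  dB-eB i = FP.toℕ-injective (trans (toℕ-dB (eB i) (¬inA-eB i)) (trans (cong unshiftB (toℕ-eB i)) (unshiftB-shiftB (toℕ i))))

  eB-dB : ∀ x → ¬ InA x → eB (dB x) ≡ x
  eB-dB x x∉A = FP.toℕ-injective (trans (toℕ-eB (dB x))
    (trans (cong shiftB (toℕ-dB x x∉A)) (shiftB-unshiftB (toℕ x) (outside-A x x∉A))))

  image-cases : ∀ x → (∃ λ i → eA i ≡ x) ⊎ (∃ λ i → eB i ≡ x)
  image-cases x with inA? x
  ... | yes x∈A = inj₁ (dA x , eA-dA x x∈A)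
  ... | no  x∉A = inj₂ (dB x , eB-dB x x∉A)

  eA-injective : ∀ {i i′} → eA i ≡ eA i′ → i ≡ i′
  eA-injective {i} {i′} e = trans (sym (dA-eA i)) (trans (cong dA e) (dA-eA i′))

  eB-injective : ∀ {i i′} → eB i ≡ eB i′ → i ≡ i′
  eB-injective {i} {i′} e = trans (sym (dB-eB i)) (trans (cong dB e) (dB-eB i′))

  glue : (H j → H j) → (H k → H k) → H (suc n) → H (suc n)
  glue αA αB x with inA? x
  ... | yes _ = eA (αA (dA x))
  ... | no  _ = eB (αB (dB x))

  module _ (αA : H j → H j) (αB : H k → H k) where

    glue-eA : ∀ i → glue αA αB (eA i) ≡ eA (αA i)
    glue-eA i with inA? (eA i)
    ... | yes _   = cong (eA ∘ αA) (dA-eA i)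
    ... | no  x∉A = contradiction (inA-eA i) x∉A

    glue-eB : ∀ i → glue αA αB (eB i) ≡ eB (αB i)
    glue-eB i with inA? (eB i)
    ... | yes x∈A = contradiction x∈A (¬inA-eB i)
    ... | no  _   = cong (eB ∘ αB) (dB-eB i)

    glue-unique : {α : H (suc n) → H (suc n)} → (∀ i → α (eA i) ≡ eA (αA i)) → (∀ i → α (eB i) ≡ eB (αB i)) →
      ∀ x → glue αA αB x ≡ α x
    glue-unique αeA αeB x with image-cases x
    ... | inj₁ (i , refl) = trans (glue-eA i) (sym (αeA i))
    ... | inj₂ (i , refl) = trans (glue-eB i) (sym (αeB i))

  module Restriction {α : H (suc n) → H (suc n)} (inv : Involutive _≡_ α) (fpf : ∀ x → α x ≢ x)
                     (α-preserves-A : ∀ x → InA x → InA (α x)) where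

    αA : H j → H j
    αA = dA ∘ α ∘ eA

    αB : H k → H k
    αB = dB ∘ α ∘ eB

    α-preserves-B : ∀ x → ¬ InA x → ¬ InA (α x)
    α-preserves-B x x∉A αx∈A = x∉A (subst InA (inv x) (α-preserves-A (α x) αx∈A))

    α-eA : ∀ i → α (eA i) ≡ eA (αA i)
    α-eA i = sym (eA-dA _ (α-preserves-A _ (inA-eA i)))

    α-eB : ∀ i → α (eB i) ≡ eB (αB i)
    α-eB i = sym (eB-dB _ (α-preserves-B _ (¬inA-eB i)))

    αA-involutive : Involutive _≡_ αA
    αA-involutive i = trans (cong (dA ∘ α) (sym (α-eA i))) (trans (cong dA (inv (eA i))) (dA-eA i))

    αB-involutive : Involutive _≡_ αB
    αB-involutive i = trans (cong (dB ∘ α) (sym (α-eB i))) (trans (cong dB (inv (eB i))) (dB-eB i))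

    αA-fixedPointFree : ∀ i → αA i ≢ i
    αA-fixedPointFree i αi≡i = fpf (eA i) (trans (α-eA i) (cong eA αi≡i))

    αB-fixedPointFree : ∀ i → αB i ≢ i
    αB-fixedPointFree i αi≡i = fpf (eB i) (trans (α-eB i) (cong eB αi≡i))

  p-split : a + suc (2 * k) ≡ suc (2 * suc n)
  p-split = ℕP.suc-injective (trans (sym (ℕP.+-suc a (suc (2 * k)))) (sym size-split))

  eA-r : eA (r j) ≡ one n
  eA-r = FP.toℕ-injective (toℕ-eA (r j))

  toℕ-eA-p : toℕ (eA (p j)) ≡ a
  toℕ-eA-p = trans (toℕ-eA (p j)) (cong suc (toℕ-p j))

  eB-r : eB (r k) ≡ r (suc n)
  eB-r = FP.toℕ-injective (toℕ-eB (r k))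

  eB-p : eB (p k) ≡ p (suc n)
  eB-p = FP.toℕ-injective (trans (toℕ-eB (p k)) (trans (cong shiftB (toℕ-p k)) (trans p-split (sym (toℕ-p (suc n))))))

  module Decomposition {α : H (suc n) → H (suc n)} {αA : H j → H j} {αB : H k → H k}
                       (A : IsPlanted j αA) (B : IsPlanted k αB)
                       (α-eA : ∀ i → α (eA i) ≡ eA (αA i)) (α-eB : ∀ i → α (eB i) ≡ eB (αB i)) where

    module A = IsPlanted A
    module B = IsPlanted B

    α-involutive : Involutive _≡_ α
    α-involutive x with image-cases x
    ... | inj₁ (i , refl) = trans (cong α (α-eA i)) (trans (α-eA (αA i)) (cong eA (A.involutive i)))
    ... | inj₂ (i , refl) = trans (cong α (α-eB i)) (trans (α-eB (αB i)) (cong eB (B.involutive i)))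

    α-fixedPointFree : ∀ x → α x ≢ x
    α-fixedPointFree x with image-cases x
    ... | inj₁ (i , refl) = A.fixedPointFree i ∘ eA-injective ∘ trans (sym (α-eA i))
    ... | inj₂ (i , refl) = B.fixedPointFree i ∘ eB-injective ∘ trans (sym (α-eB i))

    α-root : α (r (suc n)) ≡ p (suc n)
    α-root = begin
      α (r (suc n))     ≡⟨ cong α eB-r ⟨
      α (eB (r k))      ≡⟨ α-eB (r k) ⟩
      eB (αB (r k))     ≡⟨ cong eB B.root ⟩
      eB (p k)          ≡⟨ eB-p ⟩
      p (suc n)         ∎
      where open ≡-Reasoning

    σα : H (suc n) → H (suc n)
    σα = σ (suc n) α

    σA : H j → H j
    σA = σ j αA

    σB : H k → H k
    σB = σ k αB

    aF : H (suc n)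
    aF = eA (p j)

    γ-eA : ∀ {i} → toℕ i < suc (2 * j) → γ (suc n) (eA i) ≡ eA (γ j i)
    γ-eA {i} i<p = FP.toℕ-injective (begin
      toℕ (γ (suc n) (eA i))  ≡⟨ toℕ-γ (suc n) eAi<p ⟩
      suc (toℕ (eA i))        ≡⟨ cong suc (toℕ-eA i) ⟩
      suc (suc (toℕ i))       ≡⟨ cong suc (toℕ-γ j i<p) ⟨
      suc (toℕ (γ j i))       ≡⟨ toℕ-eA (γ j i) ⟨
      toℕ (eA (γ j i))        ∎)
      where
      open ≡-Reasoning
      eAi<p : toℕ (eA i) < suc (2 * suc n)
      eAi<p = subst (_< suc (2 * suc n)) (sym (toℕ-eA i)) (ℕP.<-≤-trans (s≤s i<p) (ℕP.≤-pred a<size))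

    σ-eA : ∀ {i} → toℕ i < suc (2 * j) → σα (eA i) ≡ eA (σA i)
    σ-eA {i} i<p = trans (cong α (γ-eA i<p)) (α-eA (γ j i))

    σ-r : σα (r (suc n)) ≡ aF
    σ-r = begin
      α (γ (suc n) (r (suc n)))  ≡⟨ cong α (FP.toℕ-injective (trans (toℕ-γ (suc n) ℕ.z<s) (sym (toℕ-eA (r j))))) ⟩
      α (eA (r j))               ≡⟨ α-eA (r j) ⟩
      eA (αA (r j))              ≡⟨ cong eA A.root ⟩
      aF                         ∎
      where open ≡-Reasoning

    -- eS places H k at a, a+1, …; it differs from eB only in sending r to a instead of r.
    eS : H k → H (suc n)
    eS i = (a + toℕ i) mod size (suc n)

    toℕ-eS : ∀ i → toℕ (eS i) ≡ a + toℕ i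
    toℕ-eS i = toℕ-mod (subst (a + toℕ i <_) (sym size-split) (ℕP.+-monoʳ-< a (FP.toℕ<n i)))

    γ-eS : ∀ {i} → toℕ i < suc (2 * k) → γ (suc n) (eS i) ≡ eB (γ k i)
    γ-eS {i} i<p = FP.toℕ-injective (begin
      toℕ (γ (suc n) (eS i))    ≡⟨ toℕ-γ (suc n) eSi<p ⟩
      suc (toℕ (eS i))          ≡⟨ cong suc (toℕ-eS i) ⟩
      suc (a + toℕ i)           ≡⟨ ℕP.+-suc a (toℕ i) ⟨
      shiftB (suc (toℕ i))      ≡⟨ cong shiftB (toℕ-γ k i<p) ⟨
      shiftB (toℕ (γ k i))      ≡⟨ toℕ-eB (γ k i) ⟨
      toℕ (eB (γ k i))          ∎)
      where
      open ≡-Reasoning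
      eSi<p : toℕ (eS i) < suc (2 * suc n)
      eSi<p = subst (_< suc (2 * suc n)) (sym (toℕ-eS i)) (subst (a + toℕ i <_) p-split (ℕP.+-monoʳ-< a i<p))

    r≢aF : r (suc n) ≢ aF
    r≢aF r≡aF = contradiction (trans (cong toℕ r≡aF) toℕ-eA-p) λ ()

    transpose-eB : ∀ y → transpose (r (suc n)) aF (eB y) ≡ eS y
    transpose-eB Fin.zero    = trans (cong (transpose (r (suc n)) aF) eB-r)
                                     (trans (transpose-ˡ (r (suc n)) aF)
                                            (FP.toℕ-injective (trans toℕ-eA-p (sym (trans (toℕ-eS Fin.zero) (ℕP.+-identityʳ a))))))
    transpose-eB (Fin.suc y) = trans (transpose-other (r (suc n)) aF eB≢r eB≢aF)
                                     (FP.toℕ-injective (trans (toℕ-eB (Fin.suc y)) (sym (toℕ-eS (Fin.suc y)))))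
      where
      eB≢r : eB (Fin.suc y) ≢ r (suc n)
      eB≢r e = contradiction (trans (sym (toℕ-eB (Fin.suc y))) (cong toℕ e)) λ ()
      eB≢aF : eB (Fin.suc y) ≢ aF
      eB≢aF e = ℕP.<-irrefl (sym (trans (sym (toℕ-eB (Fin.suc y))) (trans (cong toℕ e) toℕ-eA-p))) (ℕP.m<m+n a ℕ.z<s)

    -- σ′ has one cycle more than σα, fixes r and p, and acts as σA on the eA-positions 1 … 2j+1 and
    -- as σB on the eS-positions a … a+2k; counting its cycle minima block by block gives the decomposition.
    σ′ : H (suc n) → H (suc n)
    σ′ = transpose (r (suc n)) aF ∘ σα

    σ′-eS : ∀ {i} → toℕ i < suc (2 * k) → σ′ (eS i) ≡ eS (σB i)
    σ′-eS {i} i<p = begin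
      transpose (r (suc n)) aF (α (γ (suc n) (eS i)))  ≡⟨ cong (transpose (r (suc n)) aF ∘ α) (γ-eS i<p) ⟩
      transpose (r (suc n)) aF (α (eB (γ k i)))         ≡⟨ cong (transpose (r (suc n)) aF) (α-eB (γ k i)) ⟩
      transpose (r (suc n)) aF (eB (σB i))              ≡⟨ transpose-eB (σB i) ⟩
      eS (σB i)                                         ∎
      where open ≡-Reasoning

    σ′-eA : ∀ {i} → toℕ i < suc (2 * j) → σ′ (eA i) ≡ eA (σA i)
    σ′-eA {i} i<p = trans (cong (transpose (r (suc n)) aF) (σ-eA i<p)) (transpose-other (r (suc n)) aF eA≢r eA≢aF)
      where
      eA≢r : eA (σA i) ≢ r (suc n)
      eA≢r e = contradiction (trans (sym (toℕ-eA (σA i))) (cong toℕ e)) λ ()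
      eA≢aF : eA (σA i) ≢ aF
      eA≢aF e = ℕP.<-irrefl (cong toℕ (eA-injective e)) (subst (toℕ (σA i) <_) (sym (toℕ-p j)) (σ-below-p j αA A.involutive A.root i<p))

    σα-injective : Injective _≡_ _≡_ σα
    σα-injective = σ-injective (suc n) α α-involutive α-root

    σ′-injective : Injective _≡_ _≡_ σ′
    σ′-injective = σα-injective ∘ transpose-injective (r (suc n)) aF

    σ′-r : σ′ (r (suc n)) ≡ r (suc n)
    σ′-r = trans (cong (transpose (r (suc n)) aF) σ-r) (transpose-ʳ (r (suc n)) aF)

    σ′-p : σ′ (p (suc n)) ≡ p (suc n)
    σ′-p = trans (cong (transpose (r (suc n)) aF) (σ-p (suc n) α α-involutive α-root)) (transpose-other (r (suc n)) aF p≢r p≢aF)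
      where
      p≢r : p (suc n) ≢ r (suc n)
      p≢r e = contradiction (trans (sym (toℕ-p (suc n))) (cong toℕ e)) λ ()
      p≢aF : p (suc n) ≢ aF
      p≢aF e = ℕP.<-irrefl (trans (sym toℕ-eA-p) (trans (cong toℕ (sym e)) (trans (toℕ-p (suc n)) (sym p-split))))
                           (ℕP.m<m+n a ℕ.z<s)

    numCycles-σ′ : numCycles (size (suc n)) σ′ ≡ suc (numCycles (size (suc n)) σα)
    numCycles-σ′ = numCycles-transpose-split σα-injective r≢aF (1 , σ-r)

    σA-injective : Injective _≡_ _≡_ σA
    σA-injective = σ-injective j αA A.involutive A.root

    σB-injective : Injective _≡_ _≡_ σB
    σB-injective = σ-injective k αB B.involutive B.root

    least′? : Decidable (AtFin (IsLeastInCycle σ′))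
    least′? = atFin? (isLeastInCycle? σ′-injective)

    leastA? : Decidable (AtFin (IsLeastInCycle σA))
    leastA? = atFin? (isLeastInCycle? σA-injective)

    leastB? : Decidable (AtFin (IsLeastInCycle σB))
    leastB? = atFin? (isLeastInCycle? σB-injective)

    countA : count (least′? ∘ (1 +_)) (suc (2 * j)) ≡ count leastA? (suc (2 * j))
    countA = CountShift.count-leastInCycle-shift σ′-injective σA-injective 1 (suc (2 * j)) (ℕP.n≤1+n _) (ℕP.<⇒≤ a<size)
               eA (λ i _ → toℕ-eA i) (λ _ → σ-below-p j αA A.involutive A.root) (λ _ → σ′-eA)

    countB : count (least′? ∘ (a +_)) (suc (2 * k)) ≡ count leastB? (suc (2 * k))
    countB = CountShift.count-leastInCycle-shift σ′-injective σB-injective a (suc (2 * k)) (ℕP.n≤1+n _)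
               (ℕP.<⇒≤ (subst (_< size (suc n)) (sym p-split) (ℕP.n<1+n _)))
               eS (λ i _ → toℕ-eS i) (λ _ → σ-below-p k αB B.involutive B.root) (λ _ → σ′-eS)

    numCycles-decomposition : numCycles (size (suc n)) σα + 1 ≡ numCycles (size j) σA + numCycles (size k) σB
    numCycles-decomposition = begin
      numCycles (size (suc n)) σα + 1                        ≡⟨ ℕP.+-comm _ 1 ⟩
      suc (numCycles (size (suc n)) σα)                      ≡⟨ numCycles-σ′ ⟨
      numCycles (size (suc n)) σ′                            ≡⟨ numCycles≡countLeast σ′-injective ⟩
      count least′? (size (suc n))                           ≡⟨ cong (count least′?) size-split ⟩
      count least′? (a + size k)                             ≡⟨ count-+ least′? a (size k) ⟩
      count least′? (1 + suc (2 * j)) + count (least′? ∘ (a +_)) (size k)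
                                                             ≡⟨ cong (_+ count (least′? ∘ (a +_)) (size k)) (count-+ least′? 1 (suc (2 * j))) ⟩
      (indicator (least′? 0) + count (least′? ∘ (1 +_)) (suc (2 * j))) +
        (count (least′? ∘ (a +_)) (suc (2 * k)) + indicator (least′? (a + suc (2 * k))))
                                                             ≡⟨ cong₂ _+_ (cong₂ _+_ r-least countA) (cong₂ _+_ countB p-least) ⟩
      (1 + count leastA? (suc (2 * j))) + (count leastB? (suc (2 * k)) + 1)
                                                             ≡⟨ cong (_+ (count leastB? (suc (2 * k)) + 1)) (ℕP.+-comm 1 (count leastA? (suc (2 * j)))) ⟩
      (count leastA? (suc (2 * j)) + 1) + (count leastB? (suc (2 * k)) + 1)
                                                             ≡⟨ cong₂ _+_ (numCycles-σ≡countBelow-p+1 j αA A.involutive A.root)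
                                                                          (numCycles-σ≡countBelow-p+1 k αB B.involutive B.root) ⟨
      numCycles (size j) σA + numCycles (size k) σB          ∎
      where
      open ≡-Reasoning
      r-least : indicator (least′? 0) ≡ 1
      r-least = indicator-yes (least′? 0) (ℕ.z<s , fixedPoint⇒isLeastInCycle σ′-r)
      p-least : indicator (least′? (a + suc (2 * k))) ≡ 1
      p-least = indicator-yes (least′? _) (h , subst (IsLeastInCycle σ′)
                  (FP.toℕ-injective (trans (toℕ-p (suc n)) (trans (sym p-split) (sym (FP.toℕ-fromℕ< h)))))
                  (fixedPoint⇒isLeastInCycle σ′-p))
        where
        h : a + suc (2 * k) < size (suc n)
        h = subst (_< size (suc n)) (sym p-split) (ℕP.n<1+n _)

    α-one : α (one n) ≡ aF
    α-one = trans (cong α (sym eA-r)) (trans (α-eA (r j)) (cong eA A.root))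

    α-nested : Nested n α
    α-nested x 1<x x<α1 = subst₂ _<_ (sym (trans (cong toℕ αx≡) (toℕ-eA (αA i)))) (sym (trans (cong toℕ α-one) toℕ-eA-p))
                                    (s≤s αi<p)
      where
      x<a : toℕ x < a
      x<a = subst (toℕ x <_) (trans (cong toℕ α-one) toℕ-eA-p) x<α1
      x∈A : InA x
      x∈A = ℕP.<-trans ℕ.z<s 1<x , ℕP.<⇒≤ x<a
      i : H j
      i = dA x
      αx≡ : α x ≡ eA (αA i)
      αx≡ = trans (cong α (sym (eA-dA x x∈A))) (α-eA i)
      αi<p : toℕ (αA i) < suc (2 * j)
      αi<p with below-p-or-p j (αA i)
      ... | inj₁ αi<p = αi<p
      ... | inj₂ αi≡p = contradiction (cong toℕ (sym x≡eAr)) (ℕP.<⇒≢ 1<x)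
        where
        x≡eAr : x ≡ eA (r j)
        x≡eAr = trans (sym (eA-dA x x∈A)) (cong eA (trans (sym (A.involutive i)) (trans (cong αA αi≡p) (α-p A))))

    InnerA : H (suc n) → Set
    InnerA y = ∃ λ i → toℕ i < suc (2 * j) × eA i ≡ y

    σα-preserves-InnerA : ∀ y → InnerA y → InnerA (σα y)
    σα-preserves-InnerA _ (i , i<p , refl) = σA i , σ-below-p j αA A.involutive A.root i<p , sym (σ-eA i<p)

    one≁α-one : ¬ SameCycle σα (one n) (α (one n))
    one≁α-one (t , e) with iter-preserves InnerA σα-preserves-InnerA t (r j , ℕ.z<s , eA-r)
    ... | i , i<p , eAi≡ = ℕP.<-irrefl (cong toℕ (eA-injective (trans eAi≡ (trans e α-one)))) (subst (toℕ i <_) (sym (toℕ-p j)) i<p)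

    α-typeIII : TypeIII n α
    α-typeIII = one≁α-one , α-nested

    genus-α : ∀ {G₁ G₂} → numCycles (size j) σA + 2 * G₁ ≡ j + 2 → numCycles (size k) σB + 2 * G₂ ≡ k + 2 →
      numCycles (size (suc n)) σα + 2 * (G₁ + G₂) ≡ suc n + 2
    genus-α {G₁} {G₂} A-genus B-genus =
      subst (λ t → numCycles (size (suc n)) σα + 2 * (G₁ + G₂) ≡ suc t + 2) j+k≡n
            (genus-+ (numCycles (size (suc n)) σα) (numCycles (size j) σA) (numCycles (size k) σB) G₁ G₂ j k
                     numCycles-decomposition A-genus B-genus)

    α-isU : ∀ {g G₁ G₂} → IsU G₁ j αA → IsU G₂ k αB → G₁ + G₂ ≡ suc g → IsU (suc g) (suc n) α
    α-isU {g} {G₁} {G₂} A-isU B-isU G₁+G₂≡ = record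
      { involution = α-involutive ; fixedPointFree = α-fixedPointFree ; root = α-root
      ; genus = subst (λ G → numCycles (size (suc n)) σα + 2 * G ≡ suc n + 2) G₁+G₂≡
                      (genus-α {G₁} {G₂} (IsU.genus A-isU) (IsU.genus B-isU)) }

    genus-sum : ∀ {g G₁ G₂} → IsU (suc g) (suc n) α → numCycles (size j) σA + 2 * G₁ ≡ j + 2 →
      numCycles (size k) σB + 2 * G₂ ≡ k + 2 → G₁ + G₂ ≡ suc g
    genus-sum {g} {G₁} {G₂} α-isU A-genus B-genus = ℕP.*-cancelˡ-≡ _ _ 2
      (ℕP.+-cancelˡ-≡ (numCycles (size (suc n)) σα) _ _ (trans (genus-α {G₁} {G₂} A-genus B-genus) (sym (IsU.genus α-isU))))

module Extraction {g n : ℕ} {α : H (suc n) → H (suc n)} (α∈U : IsU (suc g) (suc n) α)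
                  (nested : Nested n α) where

  open IsU α∈U

  a₀ : ℕ
  a₀ = toℕ (α (one n))

  one≢p : one n ≢ p (suc n)
  one≢p e = contradiction (trans (cong toℕ e) (toℕ-p (suc n))) λ ()

  α-one≢r : α (one n) ≢ r (suc n)
  α-one≢r e = one≢p (trans (sym (involution (one n))) (trans (cong α e) root))

  α-one≢p : α (one n) ≢ p (suc n)
  α-one≢p e = contradiction (trans (sym (involution (one n))) (trans (cong α e) (α-p (isPlanted α∈U)))) λ ()

  2≤a₀ : 2 ≤ a₀
  2≤a₀ with α (one n) | α-one≢r | fixedPointFree (one n)
  ... | Fin.zero            | ≢r | _  = contradiction refl ≢r
  ... | Fin.suc Fin.zero    | _  | ≢1 = contradiction refl ≢1
  ... | Fin.suc (Fin.suc _) | _  | _  = s≤s (s≤s z≤n)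

  a₀<p : a₀ < suc (2 * suc n)
  a₀<p with below-p-or-p (suc n) (α (one n))
  ... | inj₁ a₀<p = a₀<p
  ... | inj₂ α-one≡p = contradiction α-one≡p α-one≢p

  α-preserves-block : ∀ x → InBlock a₀ x → InBlock a₀ (α x)
  α-preserves-block x (0<x , x≤a₀) with ℕP.m≤n⇒m<n∨m≡n x≤a₀ | ℕP.m≤n⇒m<n∨m≡n 0<x
  ... | inj₂ x≡a₀ | _ = subst (InBlock a₀) (sym (trans (cong α (FP.toℕ-injective x≡a₀)) (involution (one n))))
                              (ℕ.z<s , ℕP.<⇒≤ 2≤a₀)
  ... | inj₁ _    | inj₂ 1≡x = subst (InBlock a₀) (cong α (FP.toℕ-injective {i = one n} 1≡x))
                                     (ℕP.<-≤-trans ℕ.z<s 2≤a₀ , ℕP.≤-refl)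
  ... | inj₁ x<a₀ | inj₁ 1<x = 0<αx , ℕP.<⇒≤ (nested x 1<x x<a₀)
    where
    0<αx : 0 < toℕ (α x)
    0<αx with α x in αx≡
    ... | Fin.suc _ = ℕ.z<s
    ... | Fin.zero  = contradiction (trans (cong toℕ (trans (sym (involution x)) (trans (cong α αx≡) root))) (toℕ-p (suc n)))
                                    (ℕP.<⇒≢ (ℕP.<-trans x<a₀ a₀<p))

  -- The block {1, …, α 1} is a union of edges, hence of even size 2j+2.  The definition is opaque
  -- so that j, found by counting, is never unfolded during type checking.
  opaque
    block-size : Σ (Fin (suc n)) λ j → size (toℕ j) ≡ a₀
    block-size with invariant-even α involution fixedPointFree (inBlock? a₀) α-preserves-block
    ... | zero  , 0≡count = contradiction (trans 0≡count (countFin-inBlock a₀ (ℕP.m<n⇒m<1+n a₀<p)))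
                                          (ℕP.<⇒≢ (ℕP.<-trans ℕ.z<s 2≤a₀))
    ... | suc j , 2N≡count = fromℕ< j<1+n , trans (cong size (FP.toℕ-fromℕ< j<1+n)) size-j
      where
      size-j : size j ≡ a₀
      size-j = trans (sym (ℕP.*-suc 2 j)) (trans 2N≡count (countFin-inBlock a₀ (ℕP.m<n⇒m<1+n a₀<p)))
      j<1+n : j < suc n
      j<1+n = ℕP.*-cancelˡ-≤ 2 (subst (_≤ 2 * suc n) (sym (trans (ℕP.*-suc 2 j) size-j)) (ℕP.≤-pred a₀<p))

  module Components (j : Fin (suc n)) (size-j : size (toℕ j) ≡ a₀) where

    k : ℕ
    k = n ∸ toℕ j

    open Layout n (toℕ j) k (toℕ+[n∸toℕ]≡n j) public

    α-preserves-A : ∀ x → InA x → InA (α x)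
    α-preserves-A = subst (λ c → ∀ x → InBlock c x → InBlock c (α x)) (sym size-j) α-preserves-block

    open Restriction involution fixedPointFree α-preserves-A public

    αA-root : αA (r (toℕ j)) ≡ p (toℕ j)
    αA-root = begin
      dA (α (eA (r (toℕ j))))   ≡⟨ cong (dA ∘ α) eA-r ⟩
      dA (α (one n))            ≡⟨ cong dA (FP.toℕ-injective (trans (sym size-j) (sym toℕ-eA-p))) ⟩
      dA (eA (p (toℕ j)))       ≡⟨ dA-eA (p (toℕ j)) ⟩
      p (toℕ j)                 ∎
      where open ≡-Reasoning

    αB-root : αB (r k) ≡ p k
    αB-root = begin
      dB (α (eB (r k)))    ≡⟨ cong (dB ∘ α) eB-r ⟩
      dB (α (r (suc n)))   ≡⟨ cong dB root ⟩
      dB (p (suc n))       ≡⟨ cong dB eB-p ⟨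
      dB (eB (p k))        ≡⟨ dB-eB (p k) ⟩
      p k                  ∎
      where open ≡-Reasoning

    A-isPlanted : IsPlanted (toℕ j) αA
    A-isPlanted = record { involutive = αA-involutive ; fixedPointFree = αA-fixedPointFree ; root = αA-root }

    B-isPlanted : IsPlanted k αB
    B-isPlanted = record { involutive = αB-involutive ; fixedPointFree = αB-fixedPointFree ; root = αB-root }

    open Decomposition {α = α} A-isPlanted B-isPlanted α-eA α-eB using (genus-sum)

    A-genus : ∃ λ G → numCycles (size (toℕ j)) (σ (toℕ j) αA) + 2 * G ≡ toℕ j + 2
    A-genus = ∃-genus (toℕ j) αA αA-involutive αA-fixedPointFree

    B-genus : ∃ λ G → numCycles (size k) (σ k αB) + 2 * G ≡ k + 2
    B-genus = ∃-genus k αB αB-involutive αB-fixedPointFree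

    G₁+G₂≡1+g : proj₁ A-genus + proj₁ B-genus ≡ suc g
    G₁+G₂≡1+g = genus-sum {g} {proj₁ A-genus} {proj₁ B-genus} α∈U (proj₂ A-genus) (proj₂ B-genus)

    G₁<2+g : proj₁ A-genus < suc (suc g)
    G₁<2+g = s≤s (subst (proj₁ A-genus ≤_) G₁+G₂≡1+g (ℕP.m≤m+n (proj₁ A-genus) (proj₁ B-genus)))

    g₁ : Fin (suc (suc g))
    g₁ = fromℕ< G₁<2+g

    A-isU : IsU (toℕ g₁) (toℕ j) αA
    A-isU = record { involution = αA-involutive ; fixedPointFree = αA-fixedPointFree ; root = αA-root
                   ; genus = subst (λ G → numCycles (size (toℕ j)) (σ (toℕ j) αA) + 2 * G ≡ toℕ j + 2)
                                   (sym (FP.toℕ-fromℕ< G₁<2+g)) (proj₂ A-genus) }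

    B-isU : IsU (suc g ∸ toℕ g₁) k αB
    B-isU = record { involution = αB-involutive ; fixedPointFree = αB-fixedPointFree ; root = αB-root
                   ; genus = subst (λ G → numCycles (size k) (σ k αB) + 2 * G ≡ k + 2) G₂≡ (proj₂ B-genus) }
      where
      G₂≡ : proj₁ B-genus ≡ suc g ∸ toℕ g₁
      G₂≡ = sym (trans (cong₂ _∸_ (sym G₁+G₂≡1+g) (FP.toℕ-fromℕ< G₁<2+g)) (ℕP.m+n∸m≡n (proj₁ A-genus) (proj₁ B-genus)))

IsU? : ∀ g n (α : H n → H n) → Dec (IsU g n α)
IsU? g n α with FP.all? (λ x → α (α x) FP.≟ x) | FP.all? (λ x → ¬? (α x FP.≟ x)) | α (r n) FP.≟ p n
              | numCycles (size n) (σ n α) + 2 * g ℕP.≟ n + 2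
... | yes inv | yes fpf | yes root | yes genus = yes record { involution = inv ; fixedPointFree = fpf ; root = root ; genus = genus }
... | no ¬inv | _       | _        | _         = no (¬inv ∘ IsU.involution)
... | yes _   | no ¬fpf | _        | _         = no (¬fpf ∘ IsU.fixedPointFree)
... | yes _   | yes _   | no ¬root | _         = no (¬root ∘ IsU.root)
... | yes _   | yes _   | yes _    | no ¬genus = no (¬genus ∘ IsU.genus)

isU-of : (A : U g n) → IsU g n (inv A)
isU-of {g} {n} (mkU t t-isU) = recompute (IsU? g n (lookup t)) t-isU

IsU-cong : {α β : H n → H n} → (∀ x → α x ≡ β x) → IsU g n α → IsU g n β
IsU-cong {n} {g} {α} {β} α≗β α-isU = record
  { involution     = λ x → trans (sym (α≗β (β x))) (trans (cong α (sym (α≗β x))) (IsU.involution α-isU x))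
  ; fixedPointFree = λ x βx≡x → IsU.fixedPointFree α-isU x (trans (α≗β x) βx≡x)
  ; root           = trans (sym (α≗β (r n))) (IsU.root α-isU)
  ; genus          = trans (cong (_+ 2 * g) (numCycles-cong (sym ∘ α≗β ∘ γ n))) (IsU.genus α-isU) }

fromIsU : (α : H n → H n) → IsU g n α → U g n
fromIsU α α-isU = mkU (tabulate α) (IsU-cong (sym ∘ lookup∘tabulate α) α-isU)

U-ext : (A B : U g n) → (∀ x → inv A x ≡ inv B x) → A ≡ B
U-ext (mkU t _) (mkU t′ _) t≗t′ with trans (sym (tabulate∘lookup t)) (trans (tabulate-cong t≗t′) (tabulate∘lookup t′))
... | refl = refl

UIII-ext : (u v : UIII g n) → (∀ x → inv (UIII.map u) x ≡ inv (UIII.map v) x) → u ≡ v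
UIII-ext (mkUIII m _) (mkUIII m′ _) m≗m′ with U-ext m m′ m≗m′
... | refl = refl

Nested? : ∀ n (α : H (suc n) → H (suc n)) → Dec (Nested n α)
Nested? n α = FP.all? λ x → (one n Fin.<? x) →-dec ((x Fin.<? α (one n)) →-dec (α x Fin.<? α (one n)))

genus-unique : ∀ {G G′} {α β : H n → H n} → (∀ x → α x ≡ β x) → IsU G n α → IsU G′ n β → G ≡ G′
genus-unique {n} {G} {G′} {α} α≗β α-isU β-isU = ℕP.*-cancelˡ-≡ _ _ 2 (ℕP.+-cancelˡ-≡ (numCycles (size n) (σ n α)) _ _
  (trans (IsU.genus α-isU) (trans (sym (IsU.genus β-isU)) (cong (_+ 2 * G′) (numCycles-cong (sym ∘ α≗β ∘ γ n))))))

module Glue {g n : ℕ} (g₁ : Fin (suc (suc g))) (j : Fin (suc n)) (A : U (toℕ g₁) (toℕ j)) (B : U (suc g ∸ toℕ g₁) (n ∸ toℕ j)) where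

  open Layout n (toℕ j) (n ∸ toℕ j) (toℕ+[n∸toℕ]≡n j) public

  α : H (suc n) → H (suc n)
  α = lookup (tabulate (glue (inv A) (inv B)))

  α-eA : ∀ i → α (eA i) ≡ eA (inv A i)
  α-eA i = trans (lookup∘tabulate (glue (inv A) (inv B)) (eA i)) (glue-eA (inv A) (inv B) i)

  α-eB : ∀ i → α (eB i) ≡ eB (inv B i)
  α-eB i = trans (lookup∘tabulate (glue (inv A) (inv B)) (eB i)) (glue-eB (inv A) (inv B) i)

  open Decomposition {α = α} (isPlanted (isU-of A)) (isPlanted (isU-of B)) α-eA α-eB public
    using (α-one; α-isU; α-typeIII)

  toℕ-α-one : toℕ (α (one n)) ≡ size (toℕ j)
  toℕ-α-one = trans (cong toℕ α-one) toℕ-eA-p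

  restrict-eA : ∀ i → dA (α (eA i)) ≡ inv A i
  restrict-eA i = trans (cong dA (α-eA i)) (dA-eA (inv A i))

  restrict-eB : ∀ i → dB (α (eB i)) ≡ inv B i
  restrict-eB i = trans (cong dB (α-eB i)) (dB-eB (inv B i))

  glued : UIII g n
  glued = mkUIII (mkU (tabulate (glue (inv A) (inv B))) (α-isU (isU-of A) (isU-of B) (toℕ+[n∸toℕ]≡n g₁))) α-typeIII

θ : Domain g n → UIII g n
θ (g₁ , j , A , B) = Glue.glued g₁ j A B

module Extract {g n : ℕ} (m : U (suc g) (suc n)) .(isIII : IsIII m) where

  α : H (suc n) → H (suc n)
  α = inv m

  nested : Nested n α
  nested = recompute (Nested? n α) (proj₂ isIII)

  open Extraction (isU-of m) nested

  j : Fin (suc n)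
  j = proj₁ block-size

  open Components j (proj₂ block-size)

  extracted : Domain g n
  extracted = g₁ , j , fromIsU αA A-isU , fromIsU αB B-isU

  glue-extracted : ∀ x → glue (lookup (tabulate αA)) (lookup (tabulate αB)) x ≡ α x
  glue-extracted = glue-unique (lookup (tabulate αA)) (lookup (tabulate αB))
    (λ i → trans (α-eA i) (cong eA (sym (lookup∘tabulate αA i))))
    (λ i → trans (α-eB i) (cong eB (sym (lookup∘tabulate αB i))))

  θ-extracted : ∀ x → inv (UIII.map (θ extracted)) x ≡ α x
  θ-extracted x = trans (lookup∘tabulate (glue (lookup (tabulate αA)) (lookup (tabulate αB))) x) (glue-extracted x)

E : UIII g n → Domain g n
E (mkUIII m isIII) = Extract.extracted m isIII

θ∘E : (u : UIII g n) → θ (E u) ≡ u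
θ∘E (mkUIII m isIII) = UIII-ext _ _ (Extract.θ-extracted m isIII)

Domain-≡ : ∀ {g₁ g₁′ : Fin (suc (suc g))} {j : Fin (suc n)} {A A′ B B′} → g₁ ≡ g₁′ →
  (∀ i → inv A i ≡ inv A′ i) → (∀ i → inv B i ≡ inv B′ i) → _≡_ {A = Domain g n} (g₁ , j , A , B) (g₁′ , j , A′ , B′)
Domain-≡ {g₁ = g₁} {j = j} refl A≗A′ B≗B′ = cong₂ (λ A B → g₁ , j , A , B) (U-ext _ _ A≗A′) (U-ext _ _ B≗B′)

glue-injective : ∀ (g₁ : Fin (suc (suc g))) (j : Fin (suc n)) A B (g₁′ : Fin (suc (suc g))) (j′ : Fin (suc n)) A′ B′ →
  j ≡ j′ → (∀ x → Glue.α g₁ j A B x ≡ Glue.α g₁′ j′ A′ B′ x) → _≡_ {A = Domain g n} (g₁ , j , A , B) (g₁′ , j′ , A′ , B′)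
glue-injective g₁ j A B g₁′ .j A′ B′ refl α≗α′ = Domain-≡ (FP.toℕ-injective (genus-unique A≗A′ (isU-of A) (isU-of A′))) A≗A′ B≗B′
  where
  A≗A′ : ∀ i → inv A i ≡ inv A′ i
  A≗A′ i = trans (sym (Glue.restrict-eA g₁ j A B i))
             (trans (cong (Glue.dA g₁ j A B) (α≗α′ (Glue.eA g₁ j A B i))) (Glue.restrict-eA g₁′ j A′ B′ i))
  B≗B′ : ∀ i → inv B i ≡ inv B′ i
  B≗B′ i = trans (sym (Glue.restrict-eB g₁ j A B i))
             (trans (cong (Glue.dB g₁ j A B) (α≗α′ (Glue.eB g₁ j A B i))) (Glue.restrict-eB g₁′ j A′ B′ i))

θ-injective : (d d′ : Domain g n) → θ d ≡ θ d′ → d ≡ d′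
θ-injective {g} {n} (g₁ , j , A , B) (g₁′ , j′ , A′ , B′) θd≡θd′ = glue-injective g₁ j A B g₁′ j′ A′ B′ j≡j′ α≗α′
  where
  open ≡-Reasoning
  α≗α′ : ∀ x → Glue.α g₁ j A B x ≡ Glue.α g₁′ j′ A′ B′ x
  α≗α′ x = cong (λ u → inv (UIII.map u) x) θd≡θd′
  size-injective : ∀ {a b} → size a ≡ size b → a ≡ b
  size-injective e = ℕP.*-cancelˡ-≡ _ _ 2 (ℕP.suc-injective (ℕP.suc-injective e))
  j≡j′ : j ≡ j′
  j≡j′ = FP.toℕ-injective (size-injective (begin
    size (toℕ j)                                   ≡⟨ Glue.toℕ-α-one g₁ j A B ⟨
    toℕ (Glue.α g₁ j A B (one n))                  ≡⟨ cong toℕ (α≗α′ (one n)) ⟩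
    toℕ (Glue.α g₁′ j′ A′ B′ (one n))              ≡⟨ Glue.toℕ-α-one g₁′ j′ A′ B′ ⟩
    size (toℕ j′)                                  ∎))

lemma1 : (g n : ℕ) → Domain g n ⤖ UIII g n
lemma1 g n = mk⤖ {to = θ} ((λ {d} {d′} → θ-injective d d′) , λ u → E u , λ { refl → θ∘E u })
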